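{- For every finite simple graph $G$ with maximum degree $\Delta(G)$, $$2\Delta(G)-2 \le \overrightarrow{\chi_{u}}(G) \le 2^{\Delta(G)}.$$
   Context: All graphs are finite and simple. For a nonnegative integer $k$, $\mathbb{N}_k=\{1,2,\ldots,k\}$ (with $\mathbb{N}_0=\emptyset$). A universal labeling of a graph $G$ is a function $\ell: E(G)\to \mathbb{N}_k$ such that for every orientation of the edges of $G$ and every edge $uv\in E(G)$, the sum of $\ell(e)$ over the edges $e$ oriented into $u$ differs from the sum of $\ell(e)$ over the edges $e$ oriented into $v$. The universal labeling number $\overrightarrow{\chi_{u}}(G)$ is the minimum $k$ such that $G$ has a universal labeling with labels from $\mathbb{N}_k$. -}

module Defs where

open import Data.Nat using (ℕ; zero; suc; _+_; _*_; _∸_; _^_; _≤_; _⊔_)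
open import Data.Bool using (Bool; true; false; T; not; _∧_; if_then_else_)
open import Data.Fin using (Fin; zero; suc)
open import Data.Product using (Σ; _×_; _,_; ∃)
open import Relation.Binary.PropositionalEquality using (_≡_; _≢_)
open import Relation.Nullary using (¬_)

sumFin : (n : ℕ) → (Fin n → ℕ) → ℕ
sumFin zero    f = 0
sumFin (suc n) f = f zero + sumFin n (λ i → f (suc i))

maxFin : (n : ℕ) → (Fin n → ℕ) → ℕ
maxFin zero    f = 0
maxFin (suc n) f = f zero ⊔ maxFin n (λ i → f (suc i))

record Graph : Set where
  field
    n       : ℕ
    adj     : Fin n → Fin n → Bool
    adj-sym : ∀ u v → adj u v ≡ adj v u
    irrefl  : ∀ v → adj v v ≡ false

open Graph public

Adj : (G : Graph) → Fin (n G) → Fin (n G) → Set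
Adj G u v = T (adj G u v)

degree : (G : Graph) → Fin (n G) → ℕ
degree G v = sumFin (n G) (λ u → if adj G u v then 1 else 0)

maxDegree : Graph → ℕ
maxDegree G = maxFin (n G) (degree G)

-- An edge labeling with labels from ℕ_k = {1,…,k}: a value on each edge
-- {u,v} (given symmetrically on ordered adjacent pairs); values on
-- non-adjacent pairs are irrelevant.
IsLabeling : (G : Graph) → (k : ℕ) → (Fin (n G) → Fin (n G) → ℕ) → Set
IsLabeling G k ℓ =
  ∀ u v → Adj G u v → (ℓ u v ≡ ℓ v u) × (1 ≤ ℓ u v) × (ℓ u v ≤ k)

-- An orientation: d u v = true means the edge uv is oriented from u into v.
-- Each edge gets exactly one direction.
IsOrientation : (G : Graph) → (Fin (n G) → Fin (n G) → Bool) → Set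
IsOrientation G d = ∀ u v → Adj G u v → d v u ≡ not (d u v)

inSum : (G : Graph) → (Fin (n G) → Fin (n G) → ℕ) →
        (Fin (n G) → Fin (n G) → Bool) → Fin (n G) → ℕ
inSum G ℓ d v = sumFin (n G) (λ u → if adj G u v ∧ d u v then ℓ u v else 0)

IsUniversal : (G : Graph) → (Fin (n G) → Fin (n G) → ℕ) → Set
IsUniversal G ℓ =
  ∀ d → IsOrientation G d → ∀ u v → Adj G u v → inSum G ℓ d u ≢ inSum G ℓ d v

HasUniversalLabeling : Graph → ℕ → Set
HasUniversalLabeling G k = Σ (Fin (n G) → Fin (n G) → ℕ) λ ℓ →
  IsLabeling G k ℓ × IsUniversal G ℓ

IsUniversalLabelingNumber : Graph → ℕ → Set
IsUniversalLabelingNumber G k =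
  HasUniversalLabeling G k × (∀ k′ → HasUniversalLabeling G k′ → k ≤ k′)

-- Lower bound: at a vertex v of maximum degree Δ, the labels of the edges at v are distinct and none is
-- the sum of two others, for otherwise some orientation balances the in-sums at the ends of an edge.
-- Such a family of Δ positive integers ≤ k has Δ ≤ k/2 + 1: folding [1, M] at M/2, where M is the
-- largest label, maps the other labels injectively into [1, M/2], as a collision would be two equal
-- labels or two labels summing to M.
-- Upper bound: by Vizing's theorem (proved with fans and Kempe chains) G has a proper edge colouring
-- with Δ + 1 colours, and labeling an edge of colour j by 2^j is universal, since in-sums are then
-- binary numbers and the colour of an edge is a digit at exactly one of its ends.
-- The minimum exists because having a universal labeling from ℕ_k is decidable.

module Submission where

open import Defs
open import Data.Nat using (ℕ; zero; suc; pred; _+_; _*_; _∸_; _^_; _≤_; _<_; _⊓_; _/_; _<ᵇ_; z≤n; s≤s)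
open import Data.Nat.DivMod using (m/n*n≤m; m*n/n≡m; /-monoˡ-≤)
open import Data.Nat.Properties
open import Data.Bool using (Bool; true; false; T; not; _∧_; _∨_; if_then_else_)
open import Data.Fin using (Fin; zero; suc; toℕ; fromℕ; fromℕ<; combine)
open import Data.Fin.Properties
  using (any?; all?; toℕ-injective; injective⇒≤; combine-injective; ¬∀⟶∃¬-smallest;
         toℕ-fromℕ; toℕ-fromℕ<; toℕ-inject; toℕ≤pred[n])
  renaming (_≟_ to _≟ᶠ_; suc-injective to sucᶠ-injective)
open import Data.Vec.Functional using (_∷_)
open import Data.Fin.Permutation.Components using (transpose; transpose-inverse)
open import Data.Vec.Functional.Relation.Binary.Pointwise using (Pointwise)
open import Data.Product using (Σ; ∃; _×_; _,_; proj₁; proj₂; uncurry)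
open import Data.Sum using (_⊎_; inj₁; inj₂) renaming (map to ⊎-map)
open import Data.Empty using (⊥; ⊥-elim)
open import Data.Unit using (tt)
open import Data.Bool.Properties
  using (T-∧; T-≡; if-cong; not-involutive; ∧-zeroʳ; ∧-comm; ∨-comm; ¬-not) renaming (_≟_ to _≟ᵇ_)
open import Function.Bundles using (Equivalence)
open import Function using (_∘_)
open import Data.Maybe using (Maybe; just; nothing; _>>=_; fromMaybe) renaming (map to mapMaybe)
open import Data.Maybe.Properties using (just-injective)
open import Relation.Nullary using (¬_; Dec; yes; no; does; ⌊_⌋)
open import Relation.Nullary.Decidable
  using (_×-dec_; _→-dec_; ¬?; T?; decidable-stable; dec-true; dec-false; toWitness; fromWitness)
open import Relation.Binary.PropositionalEquality
open import Relation.Binary.Definitions using (tri<; tri≈; tri>)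
open import Induction.WellFounded using (module All)
import Relation.Binary.Construct.On as On
open import Data.Nat.Induction using (<-wellFounded)
open import Algebra.Properties.Semiring.Sum +-*-semiring using (sum; sum-cong-≗; ∑-distrib-+; ∑-comm; *-distribˡ-sum)

-- Finite sums and counting

-- `does` rather than ⌊_⌋, so that suc i == suc j reduces to i == j.
_==_ : ∀ {m} → Fin m → Fin m → Bool
i == j = does (i ≟ᶠ j)

==-sound : ∀ {m} (i j : Fin m) → T (i == j) → i ≡ j
==-sound i j t with i ≟ᶠ j
... | yes i≡j = i≡j

==-refl : ∀ {m} (i : Fin m) → T (i == i)
==-refl i with i ≟ᶠ i
... | yes _  = tt
... | no i≢i = i≢i refl

==-≢ : ∀ {m} {i j : Fin m} → i ≢ j → (i == j) ≡ false
==-≢ {i = i} {j} i≢j with i ≟ᶠ j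
... | yes i≡j = ⊥-elim (i≢j i≡j)
... | no _    = refl

sumFin≡sum : ∀ m (f : Fin m → ℕ) → sumFin m f ≡ sum f
sumFin≡sum zero    f = refl
sumFin≡sum (suc m) f = cong (f zero +_) (sumFin≡sum m (f ∘ suc))

sumFin-cong : ∀ m {f g : Fin m → ℕ} → (∀ i → f i ≡ g i) → sumFin m f ≡ sumFin m g
sumFin-cong zero    f≗g = refl
sumFin-cong (suc m) f≗g = cong₂ _+_ (f≗g zero) (sumFin-cong m (f≗g ∘ suc))

sumFin-mono : ∀ m {f g : Fin m → ℕ} → (∀ i → f i ≤ g i) → sumFin m f ≤ sumFin m g
sumFin-mono zero    f≤g = z≤n
sumFin-mono (suc m) f≤g = +-mono-≤ (f≤g zero) (sumFin-mono m (f≤g ∘ suc))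

sumFin-mono-< : ∀ m {f g : Fin m → ℕ} → (∀ i → f i ≤ g i) → ∀ i → f i < g i → sumFin m f < sumFin m g
sumFin-mono-< (suc m) f≤g zero    f<g = +-mono-<-≤ f<g (sumFin-mono m (f≤g ∘ suc))
sumFin-mono-< (suc m) f≤g (suc i) f<g = +-mono-≤-< (f≤g zero) (sumFin-mono-< m (f≤g ∘ suc) i f<g)

sumFin-zero : ∀ m {f : Fin m → ℕ} → (∀ i → f i ≡ 0) → sumFin m f ≡ 0
sumFin-zero zero    f≗0 = refl
sumFin-zero (suc m) f≗0 = cong₂ _+_ (f≗0 zero) (sumFin-zero m (f≗0 ∘ suc))

sumFin-distrib-+ : ∀ m (f g : Fin m → ℕ) → sumFin m (λ i → f i + g i) ≡ sumFin m f + sumFin m g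
sumFin-distrib-+ m f g = begin
  sumFin m (λ i → f i + g i) ≡⟨ sumFin≡sum m _ ⟩
  sum (λ i → f i + g i)      ≡⟨ ∑-distrib-+ f g ⟩
  sum f + sum g              ≡⟨ sym (cong₂ _+_ (sumFin≡sum m f) (sumFin≡sum m g)) ⟩
  sumFin m f + sumFin m g    ∎
  where open ≡-Reasoning

*-distribˡ-sumFin : ∀ m k (f : Fin m → ℕ) → k * sumFin m f ≡ sumFin m (λ i → k * f i)
*-distribˡ-sumFin m k f = begin
  k * sumFin m f               ≡⟨ cong (k *_) (sumFin≡sum m f) ⟩
  k * sum f                    ≡⟨ *-distribˡ-sum k f ⟩
  sum (λ i → k * f i)          ≡⟨ sym (sumFin≡sum m _) ⟩
  sumFin m (λ i → k * f i)     ∎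
  where open ≡-Reasoning

sumFin-comm : ∀ m k (f : Fin m → Fin k → ℕ) →
  sumFin m (λ i → sumFin k (f i)) ≡ sumFin k (λ j → sumFin m (λ i → f i j))
sumFin-comm m k f = begin
  sumFin m (λ i → sumFin k (f i))       ≡⟨ sumFin≡sum m _ ⟩
  sum (λ i → sumFin k (f i))            ≡⟨ sum-cong-≗ (λ i → sumFin≡sum k (f i)) ⟩
  sum (λ i → sum (f i))                 ≡⟨ ∑-comm f ⟩
  sum (λ j → sum (λ i → f i j))         ≡⟨ sym (sum-cong-≗ (λ j → sumFin≡sum m (λ i → f i j))) ⟩
  sum (λ j → sumFin m (λ i → f i j))    ≡⟨ sym (sumFin≡sum k _) ⟩
  sumFin k (λ j → sumFin m (λ i → f i j)) ∎
  where open ≡-Reasoning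

sumFin-point : ∀ m (j : Fin m) (f : Fin m → ℕ) → sumFin m (λ i → if i == j then f i else 0) ≡ f j
sumFin-point (suc m) zero    f = trans (cong (f zero +_) (sumFin-zero m (λ _ → refl))) (+-identityʳ _)
sumFin-point (suc m) (suc j) f = sumFin-point m j (f ∘ suc)

count : ∀ m → (Fin m → Bool) → ℕ
count m P = sumFin m (λ i → if P i then 1 else 0)

count-true : ∀ m → count m (λ _ → true) ≡ m
count-true zero    = refl
count-true (suc m) = cong suc (count-true m)

count-point : ∀ m (j : Fin m) → count m (_== j) ≡ 1
count-point m j = sumFin-point m j (λ _ → 1)

count-none : ∀ m (P : Fin m → Bool) → (∀ i → ¬ T (P i)) → count m P ≡ 0
count-none m P ¬P = sumFin-zero m indicator≡0
  where
  indicator≡0 : ∀ i → (if P i then 1 else 0) ≡ 0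
  indicator≡0 i with P i | ¬P i
  ... | false | _  = refl
  ... | true  | ¬t = ⊥-elim (¬t tt)

count-witness : ∀ m (P : Fin m → Bool) i → T (P i) → 1 ≤ count m P
count-witness (suc m) P zero    t with P zero
... | true = s≤s z≤n
count-witness (suc m) P (suc i) t = ≤-trans (count-witness m (P ∘ suc) i t) (m≤n+m _ _)

sumFin-indicator : ∀ m (P : Fin m → Bool) c → sumFin m (λ i → if P i then c else 0) ≡ count m P * c
sumFin-indicator zero    P c = refl
sumFin-indicator (suc m) P c with P zero
... | true  = cong (c +_) (sumFin-indicator m (P ∘ suc) c)
... | false = sumFin-indicator m (P ∘ suc) c

indicator-mono : ∀ {p q} → (T p → T q) → (if p then 1 else 0) ≤ (if q then 1 else 0)
indicator-mono {false} {_}     _   = z≤n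
indicator-mono {true}  {true}  _   = ≤-refl
indicator-mono {true}  {false} p→q = ⊥-elim (p→q tt)

count-mono : ∀ m (P Q : Fin m → Bool) → (∀ i → T (P i) → T (Q i)) → count m P ≤ count m Q
count-mono m P Q P⊆Q = sumFin-mono m (indicator-mono ∘ P⊆Q)

count-≤1 : ∀ m (P : Fin m → Bool) → (∀ i j → T (P i) → T (P j) → i ≡ j) → count m P ≤ 1
count-≤1 zero    P unique = z≤n
count-≤1 (suc m) P unique with P zero in P₀
... | true  = ≤-reflexive (cong suc (count-none m (P ∘ suc) ¬P-suc))
  where
  ¬P-suc : ∀ i → ¬ T (P (suc i))
  ¬P-suc i t with unique zero (suc i) (subst T (sym P₀) tt) t
  ... | ()
... | false = count-≤1 m (P ∘ suc) (λ i j s t → sucᶠ-injective (unique (suc i) (suc j) s t))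

count-remove : ∀ m (P : Fin m → Bool) j → count m P ≤ 1 + count m (λ i → P i ∧ not (i == j))
count-remove m P j = begin
  count m P                                                ≤⟨ sumFin-mono m split ⟩
  sumFin m (λ i → (if i == j then 1 else 0) + (if P i ∧ not (i == j) then 1 else 0))
                                                           ≡⟨ sumFin-distrib-+ m _ _ ⟩
  count m (_== j) + count m Q                              ≡⟨ cong (_+ count m Q) (count-point m j) ⟩
  1 + count m Q                                            ∎
  where
  open ≤-Reasoning
  Q = λ i → P i ∧ not (i == j)
  split : ∀ i → (if P i then 1 else 0) ≤ (if i == j then 1 else 0) + (if P i ∧ not (i == j) then 1 else 0)
  split i with P i | i == j
  ... | false | _     = z≤n
  ... | true  | true  = ≤-refl
  ... | true  | false = ≤-refl

-- Double counting: each i in P contributes to the single column f i, and each column j in Q receives at most one.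
count-injection : ∀ m k (P : Fin m → Bool) (Q : Fin k → Bool) (f : Fin m → Fin k) →
  (∀ i → T (P i) → T (Q (f i))) → (∀ i i′ → T (P i) → T (P i′) → f i ≡ f i′ → i ≡ i′) →
  count m P ≤ count k Q
count-injection m k P Q f P→Q injective = begin
  count m P                                                     ≡⟨ sumFin-cong m row ⟩
  sumFin m (λ i → count k (λ j → P i ∧ (j == f i)))             ≡⟨ sumFin-comm m k _ ⟩
  sumFin k (λ j → count m (λ i → P i ∧ (j == f i)))             ≤⟨ sumFin-mono k column ⟩
  count k Q                                                     ∎
  where
  open ≤-Reasoning
  row : ∀ i → (if P i then 1 else 0) ≡ count k (λ j → P i ∧ (j == f i))
  row i with P i
  ... | true  = sym (count-point k (f i))
  ... | false = sym (sumFin-zero k (λ _ → refl))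
  column : ∀ j → count m (λ i → P i ∧ (j == f i)) ≤ (if Q j then 1 else 0)
  column j with Q j in Qj
  ... | true  = count-≤1 m (λ i → P i ∧ (j == f i)) λ i i′ s t →
    let (Pi , j≡fi) = Equivalence.to T-∧ s ; (Pi′ , j≡fi′) = Equivalence.to T-∧ t
    in injective i i′ Pi Pi′ (trans (sym (==-sound j (f i) j≡fi)) (==-sound j (f i′) j≡fi′))
  ... | false = ≤-reflexive (count-none m (λ i → P i ∧ (j == f i)) λ i t →
    let (Pi , j≡fi) = Equivalence.to T-∧ t
    in subst T Qj (subst (T ∘ Q) (sym (==-sound j (f i) j≡fi)) (P→Q i Pi)))

-- Decidability, and the existence of the minimum

least-witness : (P : ℕ → Set) → (∀ k → Dec (P k)) → ∀ K → P K →
  ∃ λ k → (P k × (∀ k′ → P k′ → k ≤ k′)) × k ≤ K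
least-witness P P? K PK
  with ¬∀⟶∃¬-smallest (suc K) (¬_ ∘ P ∘ toℕ) (¬? ∘ P? ∘ toℕ) (λ ¬P → ¬P (fromℕ K) PfromℕK)
  where
  PfromℕK : P (toℕ (fromℕ K))
  PfromℕK = subst P (sym (toℕ-fromℕ K)) PK
... | i , ¬¬Pi , below = toℕ i , (decidable-stable (P? (toℕ i)) ¬¬Pi , minimal) , toℕ≤pred[n] i
  where
  minimal : ∀ k′ → P k′ → toℕ i ≤ k′
  minimal k′ Pk′ with toℕ i ≤? k′
  ... | yes i≤k′ = i≤k′
  ... | no i≰k′  = ⊥-elim (below (fromℕ< (≰⇒> i≰k′))
                     (subst P (sym (trans (toℕ-inject (fromℕ< (≰⇒> i≰k′))) (toℕ-fromℕ< _))) Pk′))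

Searchable : (A : Set) → (A → A → Set) → Set₁
Searchable A _≈_ = (P : A → Set) → (∀ a → Dec (P a)) → (∀ {a b} → a ≈ b → P a → P b) → Dec (∃ P)

searchable-Fin : ∀ k → Searchable (Fin k) _≡_
searchable-Fin k P P? _ = any? P?

searchable-Bool : Searchable Bool _≡_
searchable-Bool P P? _ with P? true | P? false
... | yes p | _     = yes (true , p)
... | no _  | yes p = yes (false , p)
... | no ¬t | no ¬f = no λ { (true , p) → ¬t p ; (false , p) → ¬f p }

searchable-→ : ∀ {A : Set} {_≈_ : A → A → Set} → (∀ a → a ≈ a) →
  ∀ m → Searchable A _≈_ → Searchable (Fin m → A) (Pointwise _≈_)
searchable-→ refl≈ zero    search P P? resp with P? (λ ())
... | yes p = yes (_ , p)
... | no ¬p = no λ (f , p) → ¬p (resp (λ ()) p)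
searchable-→ {A} {_≈_} refl≈ (suc m) search P P? resp
  with search (λ a → ∃ λ g → P (a ∷ g))
              (λ a → searchable-→ refl≈ m search (P ∘ (a ∷_)) (P? ∘ (a ∷_)) (resp ∘ ∷-congʳ a))
              (λ a≈b (g , p) → g , resp (∷-congˡ a≈b g) p)
  where
  ∷-congʳ : ∀ a {g h : Fin m → A} → Pointwise _≈_ g h → Pointwise _≈_ (a ∷ g) (a ∷ h)
  ∷-congʳ a g≈h zero    = refl≈ a
  ∷-congʳ a g≈h (suc i) = g≈h i
  ∷-congˡ : ∀ {a b} → a ≈ b → (g : Fin m → A) → Pointwise _≈_ (a ∷ g) (b ∷ g)
  ∷-congˡ a≈b g zero    = a≈b
  ∷-congˡ a≈b g (suc i) = refl≈ (g i)
... | yes (a , g , p) = yes (a ∷ g , p)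
... | no ¬e = no λ (f , p) → ¬e (f zero , f ∘ suc , resp (η f) p)
  where
  η : ∀ f → Pointwise _≈_ f (f zero ∷ f ∘ suc)
  η f zero    = refl≈ (f zero)
  η f (suc i) = refl≈ (f (suc i))

searchable-∀? : ∀ {A : Set} {_≈_ : A → A → Set} → (∀ {a b} → a ≈ b → b ≈ a) → Searchable A _≈_ →
  (P : A → Set) → (∀ a → Dec (P a)) → (∀ {a b} → a ≈ b → P a → P b) → Dec (∀ a → P a)
searchable-∀? sym≈ search P P? resp
  with search (¬_ ∘ P) (¬? ∘ P?) (λ a≈b ¬Pa Pb → ¬Pa (resp (sym≈ a≈b) Pb))
... | yes (a , ¬Pa) = no λ ∀P → ¬Pa (∀P a)
... | no ¬∃        = yes λ a → decidable-stable (P? a) (λ ¬Pa → ¬∃ (a , ¬Pa))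

Square : Set → ℕ → Set
Square A m = Fin m → Fin m → A

_≋_ : ∀ {A : Set} {m} → Square A m → Square A m → Set
_≋_ = Pointwise (Pointwise _≡_)

searchable-Square : ∀ {A : Set} m → Searchable A _≡_ → Searchable (Square A m) _≋_
searchable-Square m search = searchable-→ (λ f i → refl) m (searchable-→ (λ _ → refl) m search)

Adj-sym : ∀ G {u v} → Adj G u v → Adj G v u
Adj-sym G {u} {v} = subst T (adj-sym G u v)

Adj-irrefl : ∀ G {u v} → Adj G u v → u ≢ v
Adj-irrefl G {u} uv refl = subst T (irrefl G u) uv

module _ (G : Graph) where

  Agree : (ℓ ℓ′ : Square ℕ (n G)) → Set
  Agree ℓ ℓ′ = ∀ u v → Adj G u v → ℓ u v ≡ ℓ′ u v

  inSum-cong-labels : ∀ {ℓ ℓ′} → Agree ℓ ℓ′ → ∀ d v → inSum G ℓ d v ≡ inSum G ℓ′ d v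
  inSum-cong-labels {ℓ} {ℓ′} ℓ≈ℓ′ d v = sumFin-cong (n G) term
    where
    term : ∀ u → (if adj G u v ∧ d u v then ℓ u v else 0) ≡ (if adj G u v ∧ d u v then ℓ′ u v else 0)
    term u with adj G u v in uv | d u v
    ... | false | _     = refl
    ... | true  | false = refl
    ... | true  | true  = ℓ≈ℓ′ u v (subst T (sym uv) tt)

  inSum-cong-orientation : ∀ ℓ {d d′} → d ≋ d′ → ∀ v → inSum G ℓ d v ≡ inSum G ℓ d′ v
  inSum-cong-orientation ℓ d≋d′ v =
    sumFin-cong (n G) λ u → cong (λ b → if adj G u v ∧ b then ℓ u v else 0) (d≋d′ u v)

  isLabeling-cong : ∀ {k ℓ ℓ′} → Agree ℓ ℓ′ → IsLabeling G k ℓ → IsLabeling G k ℓ′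
  isLabeling-cong {k} ℓ≈ℓ′ L u v uv =
    let (ℓ-sym , ℓ-pos , ℓ-bound) = L u v uv
        e = ℓ≈ℓ′ u v uv
    in trans (sym e) (trans ℓ-sym (ℓ≈ℓ′ v u (Adj-sym G uv))) , subst (1 ≤_) e ℓ-pos , subst (_≤ k) e ℓ-bound

  isUniversal-cong : ∀ {ℓ ℓ′} → Agree ℓ ℓ′ → IsUniversal G ℓ → IsUniversal G ℓ′
  isUniversal-cong ℓ≈ℓ′ U d o u v uv eq = U d o u v uv
    (trans (inSum-cong-labels ℓ≈ℓ′ d u) (trans eq (sym (inSum-cong-labels ℓ≈ℓ′ d v))))

  isLabeling? : ∀ k ℓ → Dec (IsLabeling G k ℓ)
  isLabeling? k ℓ = all? λ u → all? λ v →
    T? (adj G u v) →-dec ((ℓ u v ≟ ℓ v u) ×-dec (1 ≤? ℓ u v) ×-dec (ℓ u v ≤? k))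

  isOrientation? : ∀ d → Dec (IsOrientation G d)
  isOrientation? d = all? λ u → all? λ v → T? (adj G u v) →-dec (d v u ≟ᵇ not (d u v))

  isUniversal? : ∀ ℓ → Dec (IsUniversal G ℓ)
  isUniversal? ℓ = searchable-∀? (λ d≋d′ u v → sym (d≋d′ u v)) (searchable-Square (n G) searchable-Bool)
    Separates separates? separates-resp
    where
    Separates : Square Bool (n G) → Set
    Separates d = IsOrientation G d → ∀ u v → Adj G u v → inSum G ℓ d u ≢ inSum G ℓ d v
    separates? : ∀ d → Dec (Separates d)
    separates? d = isOrientation? d →-dec (all? λ u → all? λ v →
      T? (adj G u v) →-dec ¬? (inSum G ℓ d u ≟ inSum G ℓ d v))
    separates-resp : ∀ {d d′} → d ≋ d′ → Separates d → Separates d′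
    separates-resp {d} {d′} d≋d′ sep o′ u v uv eq = sep o u v uv
      (trans (inSum-cong-orientation ℓ d≋d′ u) (trans eq (sym (inSum-cong-orientation ℓ d≋d′ v))))
      where
      o : IsOrientation G d
      o x y xy rewrite d≋d′ y x | d≋d′ x y = o′ x y xy

  -- A labeling with values in ℕ_k agrees on the edges with one that factors through Fin (suc k),
  -- which turns the search over all labelings into a finite one.
  hasUniversalLabeling? : ∀ k → Dec (HasUniversalLabeling G k)
  hasUniversalLabeling? k with searchable-Square (n G) (searchable-Fin (suc k)) Good good? good-resp
    where
    Good : Square (Fin (suc k)) (n G) → Set
    Good f = IsLabeling G k (λ u v → toℕ (f u v)) × IsUniversal G (λ u v → toℕ (f u v))
    good? : ∀ f → Dec (Good f)
    good? f = isLabeling? k _ ×-dec isUniversal? _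
    good-resp : ∀ {f g} → f ≋ g → Good f → Good g
    good-resp f≋g (L , U) = isLabeling-cong agree L , isUniversal-cong agree U
      where agree = λ u v _ → cong toℕ (f≋g u v)
  ... | yes (f , L , U) = yes (_ , L , U)
  ... | no ¬good = no λ (ℓ , L , U) →
    ¬good (truncate ℓ L , isLabeling-cong (agree ℓ L) L , isUniversal-cong (agree ℓ L) U)
    where
    truncate : ∀ ℓ → IsLabeling G k ℓ → Square (Fin (suc k)) (n G)
    truncate ℓ L u v with T? (adj G u v)
    ... | yes uv = fromℕ< (s≤s (proj₂ (proj₂ (L u v uv))))
    ... | no _   = zero
    agree : ∀ ℓ L → Agree ℓ (λ u v → toℕ (truncate ℓ L u v))
    agree ℓ L u v uv with T? (adj G u v)
    ... | yes _   = sym (toℕ-fromℕ< _)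
    ... | no ¬uv = ⊥-elim (¬uv uv)

  universalLabelingNumber : ∀ K → HasUniversalLabeling G K → ∃ λ k → IsUniversalLabelingNumber G k × k ≤ K
  universalLabelingNumber = least-witness (HasUniversalLabeling G) hasUniversalLabeling?

-- Lower bound

count-≤-by-injection : ∀ m (P : Fin m → Bool) (f : Fin m → ℕ) k →
  (∀ i → T (P i) → 1 ≤ f i) → (∀ i → T (P i) → f i ≤ k) →
  (∀ i j → T (P i) → T (P j) → f i ≡ f j → i ≡ j) → count m P ≤ k
count-≤-by-injection m P f k pos bound injective = begin
  count m P                            ≤⟨ count-injection m (suc k) P nonzero clamp clamp-nonzero clamp-injective ⟩
  count (suc k) nonzero                ≡⟨ count-true k ⟩
  k                                    ∎
  where
  open ≤-Reasoning
  nonzero : Fin (suc k) → Bool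
  nonzero i = not (i == zero)
  clamp : Fin m → Fin (suc k)
  clamp i = fromℕ< (s≤s (m⊓n≤n (f i) k))
  toℕ-clamp : ∀ i → T (P i) → toℕ (clamp i) ≡ f i
  toℕ-clamp i Pi = trans (toℕ-fromℕ< _) (m≤n⇒m⊓n≡m (bound i Pi))
  clamp-nonzero : ∀ i → T (P i) → T (nonzero (clamp i))
  clamp-nonzero i Pi with clamp i | toℕ-clamp i Pi | pos i Pi
  ... | suc _ | _      | _      = tt
  ... | zero  | 0≡fi   | 1≤fi   = ⊥-elim (<-irrefl 0≡fi 1≤fi)
  clamp-injective : ∀ i j → T (P i) → T (P j) → clamp i ≡ clamp j → i ≡ j
  clamp-injective i j Pi Pj eq =
    injective i j Pi Pj (trans (sym (toℕ-clamp i Pi)) (trans (cong toℕ eq) (toℕ-clamp j Pj)))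

argmax : ∀ m (P : Fin m → Bool) (a : Fin m → ℕ) →
  (∀ i → ¬ T (P i)) ⊎ (∃ λ i → T (P i) × (∀ j → T (P j) → a j ≤ a i))
argmax zero    P a = inj₁ λ ()
argmax (suc m) P a with argmax m (P ∘ suc) (a ∘ suc) | P zero in P₀
... | inj₁ none | false = inj₁ λ { zero t → subst T P₀ t ; (suc j) t → none j t }
... | inj₁ none | true  = inj₂ (zero , subst T (sym P₀) tt ,
                            λ { zero _ → ≤-refl ; (suc j) t → ⊥-elim (none j t) })
... | inj₂ (i , Pi , max) | false = inj₂ (suc i , Pi , λ { zero t → ⊥-elim (subst T P₀ t) ; (suc j) t → max j t })
... | inj₂ (i , Pi , max) | true with a zero ≤? a (suc i)
...   | yes a₀≤ = inj₂ (suc i , Pi , λ { zero _ → a₀≤ ; (suc j) t → max j t })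
...   | no a₀≰  = inj₂ (zero , subst T (sym P₀) tt ,
                    λ { zero _ → ≤-refl ; (suc j) t → ≤-trans (max j t) (<⇒≤ (≰⇒> a₀≰)) })

foldHalf : ℕ → ℕ → ℕ
foldHalf M x = x ⊓ (M ∸ x)

foldHalf*2≤ : ∀ M x → x ≤ M → foldHalf M x * 2 ≤ M
foldHalf*2≤ M x x≤M = begin
  foldHalf M x * 2          ≡⟨ *-comm (foldHalf M x) 2 ⟩
  foldHalf M x + (foldHalf M x + 0) ≡⟨ cong (foldHalf M x +_) (+-identityʳ (foldHalf M x)) ⟩
  foldHalf M x + foldHalf M x   ≤⟨ +-mono-≤ (m⊓n≤m x (M ∸ x)) (m⊓n≤n x (M ∸ x)) ⟩
  x + (M ∸ x)           ≡⟨ m+[n∸m]≡n x≤M ⟩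
  M                     ∎
  where open ≤-Reasoning

foldHalf-collision : ∀ M x y → x ≤ M → y ≤ M → foldHalf M x ≡ foldHalf M y → x ≡ y ⊎ x + y ≡ M
foldHalf-collision M x y x≤M y≤M eq with ⊓-sel x (M ∸ x) | ⊓-sel y (M ∸ y)
... | inj₁ fx | inj₁ fy = inj₁ (trans (sym fx) (trans eq fy))
... | inj₁ fx | inj₂ fy = inj₂ (trans (cong (_+ y) (trans (sym fx) (trans eq fy))) (m∸n+n≡m y≤M))
... | inj₂ fx | inj₁ fy = inj₂ (trans (cong (x +_) (trans (sym fy) (trans (sym eq) fx))) (m+[n∸m]≡n x≤M))
... | inj₂ fx | inj₂ fy = inj₁ (begin-equality
  x               ≡⟨ sym (m∸[m∸n]≡n x≤M) ⟩
  M ∸ (M ∸ x)     ≡⟨ cong (M ∸_) (trans (sym fx) (trans eq fy)) ⟩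
  M ∸ (M ∸ y)     ≡⟨ m∸[m∸n]≡n y≤M ⟩
  y               ∎)
  where open ≤-Reasoning

record IsSumFree (m : ℕ) (P : Fin m → Bool) (a : Fin m → ℕ) : Set where
  field
    distinct : ∀ {i j} → T (P i) → T (P j) → i ≢ j → a i ≢ a j
    no-sum   : ∀ {i j l} → T (P i) → T (P j) → T (P l) → i ≢ j → i ≢ l → j ≢ l → a i ≢ a j + a l

sumFree-bound : ∀ m (P : Fin m → Bool) (a : Fin m → ℕ) k → IsSumFree m P a →
  (∀ i → T (P i) → 1 ≤ a i) → (∀ i → T (P i) → a i ≤ k) → 2 * count m P ∸ 2 ≤ k
sumFree-bound m P a k sumFree pos bound with argmax m P a
... | inj₁ empty rewrite count-none m P empty = z≤n
... | inj₂ (t , Pt , max) = begin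
  2 * count m P ∸ 2         ≤⟨ ∸-monoˡ-≤ 2 (*-monoʳ-≤ 2 (count-remove m P t)) ⟩
  2 * (1 + count m Q) ∸ 2   ≡⟨ cong (_∸ 2) (*-distribˡ-+ 2 1 (count m Q)) ⟩
  2 + 2 * count m Q ∸ 2     ≡⟨ m+n∸m≡n 2 _ ⟩
  2 * count m Q             ≤⟨ *-monoʳ-≤ 2 (count-≤-by-injection m Q (foldHalf M ∘ a) (M / 2)
                                               foldHalf-pos foldHalf-≤ foldHalf-inj) ⟩
  2 * (M / 2)               ≡⟨ *-comm 2 (M / 2) ⟩
  M / 2 * 2                 ≤⟨ m/n*n≤m M 2 ⟩
  M                         ≤⟨ bound t Pt ⟩
  k                         ∎
  where
  open ≤-Reasoning
  open IsSumFree sumFree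
  M = a t
  Q : Fin m → Bool
  Q i = P i ∧ not (i == t)
  Q⇒P : ∀ {i} → T (Q i) → T (P i)
  Q⇒P = proj₁ ∘ Equivalence.to T-∧
  Q⇒≢t : ∀ {i} → T (Q i) → i ≢ t
  Q⇒≢t {i} Qi refl = subst (T ∘ not) (dec-true (i ≟ᶠ i) refl) (proj₂ (Equivalence.to T-∧ Qi))
  below : ∀ {i} → T (Q i) → a i < M
  below {i} Qi = ≤∧≢⇒< (max i (Q⇒P Qi)) (distinct (Q⇒P Qi) Pt (Q⇒≢t Qi))
  foldHalf-pos : ∀ i → T (Q i) → 1 ≤ foldHalf M (a i)
  foldHalf-pos i Qi with ⊓-sel (a i) (M ∸ a i)
  ... | inj₁ e rewrite e = pos i (Q⇒P Qi)
  ... | inj₂ e rewrite e = m<n⇒0<n∸m (below Qi)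
  foldHalf-≤ : ∀ i → T (Q i) → foldHalf M (a i) ≤ M / 2
  foldHalf-≤ i Qi = subst (_≤ M / 2) (m*n/n≡m (foldHalf M (a i)) 2)
    (/-monoˡ-≤ 2 (foldHalf*2≤ M (a i) (<⇒≤ (below Qi))))
  foldHalf-inj : ∀ i j → T (Q i) → T (Q j) → foldHalf M (a i) ≡ foldHalf M (a j) → i ≡ j
  foldHalf-inj i j Qi Qj eq with i ≟ᶠ j
  ... | yes i≡j = i≡j
  ... | no i≢j with foldHalf-collision M (a i) (a j) (<⇒≤ (below Qi)) (<⇒≤ (below Qj)) eq
  ...   | inj₁ ai≡aj = ⊥-elim (distinct (Q⇒P Qi) (Q⇒P Qj) i≢j ai≡aj)
  ...   | inj₂ sum≡M =
    ⊥-elim (no-sum Pt (Q⇒P Qi) (Q⇒P Qj) (Q⇒≢t Qi ∘ sym) (Q⇒≢t Qj ∘ sym) i≢j (sym sum≡M))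

<ᵇ-asym : ∀ x y → x ≢ y → (y <ᵇ x) ≡ not (x <ᵇ y)
<ᵇ-asym zero    zero    x≢y = ⊥-elim (x≢y refl)
<ᵇ-asym zero    (suc y) _   = refl
<ᵇ-asym (suc x) zero    _   = refl
<ᵇ-asym (suc x) (suc y) x≢y = <ᵇ-asym x y (x≢y ∘ cong suc)

sumFrom : (G : Graph) → Square ℕ (n G) → (Fin (n G) → Bool) → Fin (n G) → ℕ
sumFrom G ℓ W v = sumFin (n G) (λ x → if adj G x v ∧ W x then ℓ x v else 0)

module _ (G : Graph) (ℓ : Square ℕ (n G)) where

  sumFrom-point : ∀ {v w} → Adj G w v → sumFrom G ℓ (_== w) v ≡ ℓ w v
  sumFrom-point {v} {w} wv = trans (sumFin-cong (n G) point) (sumFin-point (n G) w (λ x → ℓ x v))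
    where
    point : ∀ x → (if adj G x v ∧ (x == w) then ℓ x v else 0) ≡ (if x == w then ℓ x v else 0)
    point x with x ≟ᶠ w
    ... | no _ rewrite ∧-zeroʳ (adj G x v) = refl
    ... | yes refl with adj G x v
    ...   | true  = refl
    ...   | false = ⊥-elim wv

  sumFrom-pair : ∀ {v w z} → w ≢ z → Adj G w v → Adj G z v →
    sumFrom G ℓ (λ x → (x == w) ∨ (x == z)) v ≡ ℓ w v + ℓ z v
  sumFrom-pair {v} {w} {z} w≢z wv zv = begin
    sumFrom G ℓ (λ x → (x == w) ∨ (x == z)) v           ≡⟨ sumFin-cong (n G) split ⟩
    sumFin (n G) (λ x → (if adj G x v ∧ (x == w) then ℓ x v else 0) + (if adj G x v ∧ (x == z) then ℓ x v else 0))
                                                        ≡⟨ sumFin-distrib-+ (n G) _ _ ⟩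
    sumFrom G ℓ (_== w) v + sumFrom G ℓ (_== z) v       ≡⟨ cong₂ _+_ (sumFrom-point wv) (sumFrom-point zv) ⟩
    ℓ w v + ℓ z v                                       ∎
    where
    open ≡-Reasoning
    split : ∀ x → (if adj G x v ∧ ((x == w) ∨ (x == z)) then ℓ x v else 0) ≡
                  (if adj G x v ∧ (x == w) then ℓ x v else 0) + (if adj G x v ∧ (x == z) then ℓ x v else 0)
    split x with x ≟ᶠ w | x ≟ᶠ z | adj G x v
    ... | yes refl | yes refl | _     = ⊥-elim (w≢z refl)
    ... | yes refl | no _     | true  = sym (+-identityʳ _)
    ... | yes refl | no _     | false = refl
    ... | no _     | yes refl | true  = refl
    ... | no _     | yes refl | false = refl
    ... | no _     | no _     | true  = refl
    ... | no _     | no _     | false = refl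


-- Orient uv into u and the other edges at u away from u; at v, orient exactly the edges from W into v;
-- the remaining edges by vertex index.
module Isolating (G : Graph) (u v : Fin (n G)) (u≢v : u ≢ v) (W : Fin (n G) → Bool) (Wu : W u ≡ false) where

  d : Square Bool (n G)
  d x y = if y == u then x == v
          else if x == u then not (y == v)
          else if y == v then W x
          else if x == v then not (W y)
          else (toℕ x <ᵇ toℕ y)

  isOrientation : IsOrientation G d
  isOrientation x y xy with y ≟ᶠ u | x ≟ᶠ u
  ... | yes refl | yes refl = ⊥-elim (Adj-irrefl G xy refl)
  ... | yes refl | no _     = refl
  ... | no _     | yes refl = sym (not-involutive _)
  ... | no _     | no _ with y ≟ᶠ v | x ≟ᶠ v
  ...   | yes refl | yes refl = ⊥-elim (Adj-irrefl G xy refl)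
  ...   | yes refl | no _     = refl
  ...   | no _     | yes refl = sym (not-involutive _)
  ...   | no _     | no _     = <ᵇ-asym (toℕ x) (toℕ y) (Adj-irrefl G xy ∘ toℕ-injective)

  inSum-u : ∀ ℓ → Adj G v u → inSum G ℓ d u ≡ ℓ v u
  inSum-u ℓ vu = trans (sumFin-cong (n G) only-v) (sumFin-point (n G) v (λ x → ℓ x u))
    where
    only-v : ∀ x → (if adj G x u ∧ d x u then ℓ x u else 0) ≡ (if x == v then ℓ x u else 0)
    only-v x rewrite dec-true (u ≟ᶠ u) refl with x ≟ᶠ v
    ... | no _ rewrite ∧-zeroʳ (adj G x u) = refl
    ... | yes refl with adj G x u
    ...   | true  = refl
    ...   | false = ⊥-elim vu

  inSum-v : ∀ ℓ → inSum G ℓ d v ≡ sumFrom G ℓ W v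
  inSum-v ℓ = sumFin-cong (n G) from-W
    where
    from-W : ∀ x → (if adj G x v ∧ d x v then ℓ x v else 0) ≡ (if adj G x v ∧ W x then ℓ x v else 0)
    from-W x rewrite ==-≢ (u≢v ∘ sym) | dec-true (v ≟ᶠ v) refl with x ≟ᶠ u
    ... | no _ = refl
    ... | yes refl rewrite Wu | ∧-zeroʳ (adj G x v) = refl

module _ {G : Graph} {k : ℕ} {ℓ : Square ℕ (n G)} (L : IsLabeling G k ℓ) (U : IsUniversal G ℓ) where

  label≢sumFrom : ∀ {u v} → Adj G u v → (W : Fin (n G) → Bool) → W u ≡ false → ℓ u v ≢ sumFrom G ℓ W v
  label≢sumFrom {u} {v} uv W Wu eq = U d isOrientation u v uv (begin
    inSum G ℓ d u   ≡⟨ inSum-u ℓ (Adj-sym G uv) ⟩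
    ℓ v u           ≡⟨ proj₁ (L v u (Adj-sym G uv)) ⟩
    ℓ u v           ≡⟨ eq ⟩
    sumFrom G ℓ W v ≡⟨ sym (inSum-v ℓ) ⟩
    inSum G ℓ d v   ∎)
    where
    open ≡-Reasoning
    open Isolating G u v (Adj-irrefl G uv) W Wu

  labels-sumFree : ∀ v → IsSumFree (n G) (λ x → adj G x v) (λ x → ℓ x v)
  labels-sumFree v = record
    { distinct = λ {u} {w} uv wv u≢w eq →
        label≢sumFrom uv (_== w) (==-≢ u≢w) (trans eq (sym (sumFrom-point G ℓ wv)))
    ; no-sum   = λ {u} {w} {z} uv wv zv u≢w u≢z w≢z eq →
        label≢sumFrom uv (λ x → (x == w) ∨ (x == z)) (cong₂ _∨_ (==-≢ u≢w) (==-≢ u≢z))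
          (trans eq (sym (sumFrom-pair G ℓ w≢z wv zv)))
    }

  degree-bound : ∀ v → 2 * degree G v ∸ 2 ≤ k
  degree-bound v = sumFree-bound (n G) (λ x → adj G x v) (λ x → ℓ x v) k (labels-sumFree v)
    (λ x xv → proj₁ (proj₂ (L x v xv))) (λ x xv → proj₂ (proj₂ (L x v xv)))

maxFin-ub : ∀ m (f : Fin m → ℕ) i → f i ≤ maxFin m f
maxFin-ub (suc m) f zero    = m≤m⊔n _ _
maxFin-ub (suc m) f (suc i) = ≤-trans (maxFin-ub m (f ∘ suc) i) (m≤n⊔m _ _)

maxFin-attained : ∀ m (f : Fin m → ℕ) → maxFin m f ≡ 0 ⊎ ∃ λ i → maxFin m f ≡ f i
maxFin-attained zero    f = inj₁ refl
maxFin-attained (suc m) f with ⊔-sel (f zero) (maxFin m (f ∘ suc))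
... | inj₁ max≡f₀ = inj₂ (zero , max≡f₀)
... | inj₂ max≡rest with maxFin-attained m (f ∘ suc)
...   | inj₁ rest≡0       = inj₁ (trans max≡rest rest≡0)
...   | inj₂ (i , rest≡f) = inj₂ (suc i , trans max≡rest rest≡f)

lowerBound : ∀ G k → HasUniversalLabeling G k → 2 * maxDegree G ∸ 2 ≤ k
lowerBound G k (ℓ , L , U) with maxFin-attained (n G) (degree G)
... | inj₁ Δ≡0       rewrite Δ≡0 = z≤n
... | inj₂ (v , Δ≡dv) rewrite Δ≡dv = degree-bound {G} L U v

-- Upper bound: powers of two along a proper edge colouring

record ProperEdgeColouring (G : Graph) (D : ℕ) : Set where
  field
    colour           : Square (Fin D) (n G)
    colour-sym       : ∀ {u v} → Adj G u v → colour u v ≡ colour v u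
    colour-injective : ∀ {u v w} → Adj G u v → Adj G u w → colour u v ≡ colour u w → v ≡ w

binary : ∀ D → (Fin D → ℕ) → ℕ
binary D p = sumFin D (λ j → p j * 2 ^ toℕ j)

binary-suc : ∀ D (p : Fin (suc D) → ℕ) → binary (suc D) p ≡ p zero + 2 * binary D (p ∘ suc)
binary-suc D p = cong₂ _+_ (*-identityʳ (p zero)) (begin
  sumFin D (λ j → p (suc j) * (2 * 2 ^ toℕ j)) ≡⟨ sumFin-cong D (λ j → *-comm-middle (p (suc j)) (2 ^ toℕ j)) ⟩
  sumFin D (λ j → 2 * (p (suc j) * 2 ^ toℕ j)) ≡⟨ sym (*-distribˡ-sumFin D 2 _) ⟩
  2 * binary D (p ∘ suc)                       ∎)
  where
  open ≡-Reasoning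
  *-comm-middle : ∀ x y → x * (2 * y) ≡ 2 * (x * y)
  *-comm-middle x y = trans (sym (*-assoc x 2 y)) (trans (cong (_* y) (*-comm x 2)) (*-assoc 2 x y))

bit+2*-injective : ∀ p q A B → p ≤ 1 → q ≤ 1 → p + 2 * A ≡ q + 2 * B → p ≡ q × A ≡ B
bit+2*-injective 0 0 A B _ _ eq = refl , *-cancelˡ-≡ A B 2 eq
bit+2*-injective 1 1 A B _ _ eq = refl , *-cancelˡ-≡ A B 2 (suc-injective eq)
bit+2*-injective 0 1 A B _ _ eq = ⊥-elim (even≢odd A B eq)
bit+2*-injective 1 0 A B _ _ eq = ⊥-elim (even≢odd B A (sym eq))
bit+2*-injective (suc (suc _)) _ A B (s≤s ()) _ eq
bit+2*-injective _ (suc (suc _)) A B _ (s≤s ()) eq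

binary-injective : ∀ D (p q : Fin D → ℕ) → (∀ j → p j ≤ 1) → (∀ j → q j ≤ 1) →
  binary D p ≡ binary D q → ∀ j → p j ≡ q j
binary-injective (suc D) p q p≤1 q≤1 eq j
  with bit+2*-injective (p zero) (q zero) _ _ (p≤1 zero) (q≤1 zero)
         (trans (sym (binary-suc D p)) (trans eq (binary-suc D q)))
... | p₀≡q₀ , rest = case j
  where
  case : ∀ j → p j ≡ q j
  case zero    = p₀≡q₀
  case (suc j) = binary-injective D (p ∘ suc) (q ∘ suc) (p≤1 ∘ suc) (q≤1 ∘ suc) rest j

module PowersOfTwo {G : Graph} {D : ℕ} (c : ProperEdgeColouring G D) where
  open ProperEdgeColouring c

  ℓ : Square ℕ (n G)
  ℓ u v = 2 ^ toℕ (colour u v)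

  InEdge : Square Bool (n G) → Fin (n G) → Fin D → Fin (n G) → Bool
  InEdge d w j x = adj G x w ∧ d x w ∧ (j == colour w x)

  digit : Square Bool (n G) → Fin (n G) → Fin D → ℕ
  digit d w j = count (n G) (InEdge d w j)

  InEdge-edge : ∀ d w j x → T (InEdge d w j x) → Adj G w x × T (d x w) × j ≡ colour w x
  InEdge-edge d w j x t =
    let (xw , rest) = Equivalence.to T-∧ t ; (dxw , j≡) = Equivalence.to T-∧ rest
    in Adj-sym G xw , dxw , ==-sound j (colour w x) j≡

  digit≤1 : ∀ d w j → digit d w j ≤ 1
  digit≤1 d w j = count-≤1 (n G) (InEdge d w j) λ x y s t →
    let (wx , _ , j≡x) = InEdge-edge d w j x s ; (wy , _ , j≡y) = InEdge-edge d w j y t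
    in colour-injective wx wy (trans (sym j≡x) j≡y)

  inSum≡binary : ∀ d w → inSum G ℓ d w ≡ binary D (digit d w)
  inSum≡binary d w = begin
    inSum G ℓ d w                                                       ≡⟨ sumFin-cong (n G) expand ⟩
    sumFin (n G) (λ x → sumFin D (λ j → if InEdge d w j x then 2 ^ toℕ j else 0))
                                                                        ≡⟨ sumFin-comm (n G) D _ ⟩
    sumFin D (λ j → sumFin (n G) (λ x → if InEdge d w j x then 2 ^ toℕ j else 0))
                                                                        ≡⟨ sumFin-cong D (λ j → sumFin-indicator (n G) _ _) ⟩
    binary D (digit d w)                                                ∎
    where
    open ≡-Reasoning
    expand : ∀ x → (if adj G x w ∧ d x w then ℓ x w else 0) ≡
                   sumFin D (λ j → if InEdge d w j x then 2 ^ toℕ j else 0)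
    expand x with adj G x w in xw | d x w
    ... | false | _     = sym (sumFin-zero D (λ _ → refl))
    ... | true  | false = sym (sumFin-zero D (λ _ → refl))
    ... | true  | true  = begin
      2 ^ toℕ (colour x w) ≡⟨ cong (λ γ → 2 ^ toℕ γ) (colour-sym (subst T (sym xw) tt)) ⟩
      2 ^ toℕ (colour w x) ≡⟨ sym (sumFin-point D (colour w x) (λ j → 2 ^ toℕ j)) ⟩
      sumFin D (λ j → if j == colour w x then 2 ^ toℕ j else 0) ∎

  digit-head : ∀ d {u v} → Adj G u v → T (d v u) → digit d u (colour u v) ≡ 1
  digit-head d {u} {v} uv dvu = ≤-antisym (digit≤1 d u (colour u v))
    (count-witness (n G) (InEdge d u (colour u v)) v
      (Equivalence.from T-∧ (Adj-sym G uv , Equivalence.from T-∧ (dvu , ==-refl (colour u v)))))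

  digit-tail : ∀ d → IsOrientation G d → ∀ {u v} → Adj G u v → T (d v u) → digit d v (colour u v) ≡ 0
  digit-tail d o {u} {v} uv dvu = count-none (n G) (InEdge d v (colour u v)) λ x t →
    let (vx , dxv , γ≡) = InEdge-edge d v (colour u v) x t
        x≡u = colour-injective vx (Adj-sym G uv) (trans (sym γ≡) (colour-sym uv))
    in subst T (trans (o v u (Adj-sym G uv)) (cong not (Equivalence.to T-≡ dvu))) (subst (λ y → T (d y v)) x≡u dxv)

  digits-equal : ∀ d {u v} → inSum G ℓ d u ≡ inSum G ℓ d v → ∀ j → digit d u j ≡ digit d v j
  digits-equal d {u} {v} eq = binary-injective D (digit d u) (digit d v) (digit≤1 d u) (digit≤1 d v)
    (trans (sym (inSum≡binary d u)) (trans eq (inSum≡binary d v)))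

  separated : ∀ d → IsOrientation G d → ∀ {x y} → Adj G x y → T (d y x) →
    digit d x (colour x y) ≢ digit d y (colour x y)
  separated d o xy dyx e with trans (sym (digit-head d xy dyx)) (trans e (digit-tail d o xy dyx))
  ... | ()

  universal : IsUniversal G ℓ
  universal d o u v uv eq with d v u in dvu
  ... | true  = separated d o uv (subst T (sym dvu) tt) (digits-equal d eq (colour u v))
  ... | false = separated d o (Adj-sym G uv) (subst T (sym (trans (o v u (Adj-sym G uv)) (cong not dvu))) tt)
                  (sym (digits-equal d eq (colour v u)))

  labeling : IsLabeling G (2 ^ pred D) ℓ
  labeling u v uv = cong (λ γ → 2 ^ toℕ γ) (colour-sym uv) , m^n>0 2 (toℕ (colour u v)) ,
    ^-monoʳ-≤ 2 (toℕ≤pred[n] (colour u v))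

-- Vizing's theorem

parity : ∀ g → ∃ λ h → g ≡ h * 2 ⊎ g ≡ suc (h * 2)
parity zero = 0 , inj₁ refl
parity (suc g) with parity g
... | h , inj₁ refl = h , inj₂ refl
... | h , inj₂ refl = suc h , inj₁ refl

gap : ∀ {i j} → i < j → ∃ λ g → j ≡ suc g + i
gap {i} i<j with m≤n⇒∃[o]m+o≡n i<j
... | o , eq = o , trans (sym eq) (cong suc (+-comm i o))

-- Alternately applying σ and τ from a point with no τ-predecessor never revisits a point:
-- going backwards from a repetition either shrinks an odd gap to a fixed point or runs an even one
-- back to the start.
module AlternatingWalk {A : Set} (σ τ : A → Maybe A)
    (σ-involutive : ∀ {a b} → σ a ≡ just b → σ b ≡ just a)
    (τ-involutive : ∀ {a b} → τ a ≡ just b → τ b ≡ just a)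
    (σ-fixfree : ∀ {a} → σ a ≢ just a) (τ-fixfree : ∀ {a} → τ a ≢ just a)
    (start : A) (start-τ : τ start ≡ nothing) where

  step : ℕ → A → Maybe A
  step zero          = σ
  step (suc zero)    = τ
  step (suc (suc i)) = step i

  walk : ℕ → Maybe A
  walk zero    = just start
  walk (suc i) = walk i >>= step i

  step-involutive : ∀ i {a b} → step i a ≡ just b → step i b ≡ just a
  step-involutive zero          = σ-involutive
  step-involutive (suc zero)    = τ-involutive
  step-involutive (suc (suc i)) = step-involutive i

  step-injective : ∀ i {a b c} → step i a ≡ just c → step i b ≡ just c → a ≡ b
  step-injective i ac bc = just-injective (trans (sym (step-involutive i ac)) (step-involutive i bc))

  step-fixfree : ∀ i {a} → step i a ≢ just a
  step-fixfree zero          = σ-fixfree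
  step-fixfree (suc zero)    = τ-fixfree
  step-fixfree (suc (suc i)) = step-fixfree i

  step-odd : ∀ h → step (suc (h * 2)) ≡ τ
  step-odd zero    = refl
  step-odd (suc h) = step-odd h

  step-period : ∀ h i → step (h * 2 + i) ≡ step i
  step-period zero    i = refl
  step-period (suc h) i = step-period h i

  walk-step : ∀ i {a} → walk i ≡ just a → walk (suc i) ≡ step i a
  walk-step i eq rewrite eq = refl

  walk-back : ∀ i {b} → walk (suc i) ≡ just b → ∃ λ a → walk i ≡ just a × step i a ≡ just b
  walk-back i eq with walk i
  ... | just a = a , refl , eq

  walk-stuck : ∀ k i → walk i ≡ nothing → walk (k + i) ≡ nothing
  walk-stuck zero    i eq = eq
  walk-stuck (suc k) i eq rewrite walk-stuck k i eq = refl

  no-repeat-even : ∀ h i {a} → walk i ≡ just a → walk (suc h * 2 + i) ≡ just a → ⊥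
  no-repeat-even h zero    {a} refl eq with walk-back (suc (h * 2 + 0)) eq
  ... | c , _ , τc≡start rewrite +-identityʳ (h * 2) | step-odd h
    with trans (sym (τ-involutive τc≡start)) start-τ
  ...   | ()
  no-repeat-even h (suc i) {a} eq eq′ with walk-back i eq
    | walk-back (suc h * 2 + i) (subst (λ j → walk j ≡ just a) (+-suc (suc h * 2) i) eq′)
  ... | c , wc , sc | c′ , wc′ , sc′ =
    no-repeat-even h i wc (subst (λ x → walk (suc h * 2 + i) ≡ just x) (step-injective i same-step sc) wc′)
    where
    same-step = subst (λ f → f c′ ≡ just _) (step-period (suc h) i) sc′

  no-repeat-odd : ∀ h i {a} → walk i ≡ just a → walk (suc (h * 2) + i) ≡ just a → ⊥
  no-repeat-odd zero    i eq eq′ = step-fixfree i (trans (sym (walk-step i eq)) eq′)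
  no-repeat-odd (suc h) i {a} eq eq′ with walk-back (suc h * 2 + i) eq′
  ... | c , wc , sc =
    no-repeat-odd h (suc i)
      (trans (walk-step i eq) (step-involutive i (subst (λ f → f c ≡ just a) (step-period (suc h) i) sc)))
      (subst (λ j → walk j ≡ just c) (sym (cong suc (+-suc (h * 2) i))) wc)

  no-repeat : ∀ g i {a} → walk i ≡ just a → walk (suc g + i) ≡ just a → ⊥
  no-repeat g i with parity g
  ... | h , inj₁ refl = no-repeat-odd h i
  ... | h , inj₂ refl = no-repeat-even h i

  walk-injective : ∀ i j {a} → walk i ≡ just a → walk j ≡ just a → i ≡ j
  walk-injective i j wi wj with <-cmp i j
  ... | tri≈ _ i≡j _ = i≡j
  ... | tri< i<j _ _ with gap i<j
  ...   | g , refl = ⊥-elim (no-repeat g i wi wj)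
  walk-injective i j wi wj | tri> _ _ j<i with gap j<i
  ...   | g , refl = ⊥-elim (no-repeat g j wj wi)

  step-alternates : ∀ i → (step i ≡ σ × step (suc i) ≡ τ) ⊎ (step i ≡ τ × step (suc i) ≡ σ)
  step-alternates zero          = inj₁ (refl , refl)
  step-alternates (suc zero)    = inj₂ (refl , refl)
  step-alternates (suc (suc i)) = step-alternates i

  Visited : A → Set
  Visited a = ∃ λ i → walk i ≡ just a

  visited-σ : ∀ {a b} → Visited a → σ a ≡ just b → Visited b
  visited-σ (zero , refl) σab = 1 , σab
  visited-σ {a} {b} (suc i , wi) σab with step-alternates i
  ... | inj₂ (_ , next≡σ) =
    suc (suc i) , trans (walk-step (suc i) wi) (subst (λ f → f a ≡ just b) (sym next≡σ) σab)
  ... | inj₁ (this≡σ , _) with walk-back i wi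
  ...   | c , wc , sca = i , trans wc (cong just (just-injective
            (trans (sym (σ-involutive (subst (λ f → f c ≡ just a) this≡σ sca))) σab)))

  visited-τ : ∀ {a b} → Visited a → τ a ≡ just b → Visited b
  visited-τ (zero , refl) τab with trans (sym τab) start-τ
  ... | ()
  visited-τ {a} {b} (suc i , wi) τab with step-alternates i
  ... | inj₁ (_ , next≡τ) =
    suc (suc i) , trans (walk-step (suc i) wi) (subst (λ f → f a ≡ just b) (sym next≡τ) τab)
  ... | inj₂ (this≡τ , _) with walk-back i wi
  ...   | c , wc , sca = i , trans wc (cong just (just-injective
            (trans (sym (τ-involutive (subst (λ f → f c ≡ just a) this≡τ sca))) τab)))

  dead-end : ∀ {a} → Visited a → τ a ≡ nothing → a ≢ start →
    ∃ λ i → walk i ≡ just a × walk (suc i) ≡ nothing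
  dead-end (zero , refl) τa a≢start = ⊥-elim (a≢start refl)
  dead-end {a} (suc i , wi) τa a≢start with step-alternates i
  ... | inj₁ (_ , next≡τ) = suc i , wi , trans (trans (walk-step (suc i) wi) (cong (λ f → f a) next≡τ)) τa
  ... | inj₂ (this≡τ , _) with walk-back i wi
  ...   | c , _ , sca with trans (sym (τ-involutive (subst (λ f → f c ≡ just a) this≡τ sca))) τa
  ...     | ()

  dead-end-unique : ∀ {i j a b} → walk i ≡ just a → walk (suc i) ≡ nothing →
    walk j ≡ just b → walk (suc j) ≡ nothing → a ≡ b
  dead-end-unique {i} {j} wi wi′ wj wj′ with <-cmp i j
  ... | tri≈ _ refl _ = just-injective (trans (sym wi) wj)
  ... | tri< i<j _ _ with gap i<j
  ...   | g , refl with trans (sym wj) (subst (λ k → walk k ≡ nothing) (+-suc g i) (walk-stuck g (suc i) wi′))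
  ...     | ()
  dead-end-unique {i} {j} wi wi′ wj wj′ | tri> _ _ j<i with gap j<i
  ...   | g , refl with trans (sym wi) (subst (λ k → walk k ≡ nothing) (+-suc g j) (walk-stuck g (suc j) wj′))
  ...     | ()

  walk-ends : ∀ N (encode : A → Fin N) → (∀ {a b} → encode a ≡ encode b → a ≡ b) → walk N ≡ nothing
  walk-ends N encode encode-injective with walk N in wN
  ... | nothing = refl
  ... | just _  = ⊥-elim (<-irrefl refl (injective⇒≤ {f = position} position-injective))
    where
    defined : ∀ (i : Fin (suc N)) → ∃ λ a → walk (toℕ i) ≡ just a
    defined i with walk (toℕ i) in wi
    ... | just a  = a , refl
    ... | nothing with trans (sym wN) (subst (λ k → walk k ≡ nothing) (m∸n+n≡m (toℕ≤pred[n] i))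
                         (walk-stuck (N ∸ toℕ i) (toℕ i) wi))
    ...   | ()
    position : Fin (suc N) → Fin N
    position i = encode (proj₁ (defined i))
    position-injective : ∀ {i j} → position i ≡ position j → i ≡ j
    position-injective {i} {j} eq = toℕ-injective (walk-injective (toℕ i) (toℕ j) (proj₂ (defined i))
      (subst (λ a → walk (toℕ j) ≡ just a) (sym (encode-injective eq)) (proj₂ (defined j))))

  visited-early : ∀ {N} → walk N ≡ nothing → ∀ {a} → Visited a → ∃ λ (i : Fin N) → walk (toℕ i) ≡ just a
  visited-early {N} wN (i , wi) with i <? N
  ... | yes i<N = fromℕ< i<N , subst (λ k → walk k ≡ _) (sym (toℕ-fromℕ< i<N)) wi
  ... | no i≮N
    with trans (sym wi) (subst (λ k → walk k ≡ nothing) (m∸n+n≡m (≮⇒≥ i≮N)) (walk-stuck (i ∸ N) N wN))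
  ...   | ()

Missing : ∀ {G D} → ProperEdgeColouring G D → Fin (n G) → Fin D → Set
Missing {G} c w j = ∀ z → Adj G w z → ProperEdgeColouring.colour c w z ≢ j

-- Opaque because clients need only the statement; unfolding the search makes checking them costly.
opaque
  missing-colour : ∀ {G D} (c : ProperEdgeColouring G D) w → degree G w < D → ∃ (Missing c w)
  missing-colour {G} {D} c w deg<D with any? (λ j → all? (λ z → T? (adj G w z) →-dec ¬? (colour w z ≟ᶠ j)))
    where open ProperEdgeColouring c
  ... | yes (j , miss) = j , miss
  ... | no none        = ⊥-elim (<-irrefl refl (≤-<-trans D≤degree deg<D))
    where
    open ProperEdgeColouring c
    used : ∀ j → ∃ λ z → Adj G w z × colour w z ≡ j
    used j with any? (λ z → T? (adj G w z) ×-dec (colour w z ≟ᶠ j))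
    ... | yes found = found
    ... | no ¬found = ⊥-elim (none (j , λ z wz cwz → ¬found (z , wz , cwz)))
    D≤degree : D ≤ degree G w
    D≤degree = subst (_≤ degree G w) (count-true D)
      (count-injection D (n G) (λ _ → true) (λ u → adj G u w) (proj₁ ∘ used)
        (λ j _ → Adj-sym G (proj₁ (proj₂ (used j))))
        (λ i j _ _ eq → trans (sym (proj₂ (proj₂ (used i)))) (trans (cong (colour w) eq) (proj₂ (proj₂ (used j))))))

module Neighbour {G : Graph} {D : ℕ} (c : ProperEdgeColouring G D) where
  open ProperEdgeColouring c

  next : Fin (n G) → Fin D → Maybe (Fin (n G))
  next w j with any? (λ z → T? (adj G w z) ×-dec (colour w z ≟ᶠ j))
  ... | yes (z , _) = just z
  ... | no _        = nothing

  next-sound : ∀ {w j z} → next w j ≡ just z → Adj G w z × colour w z ≡ j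
  next-sound {w} {j} eq with any? (λ z → T? (adj G w z) ×-dec (colour w z ≟ᶠ j))
  next-sound refl | yes (_ , edge) = edge

  next-complete : ∀ {w j z} → Adj G w z → colour w z ≡ j → next w j ≡ just z
  next-complete {w} {j} wz cwz with any? (λ z → T? (adj G w z) ×-dec (colour w z ≟ᶠ j))
  ... | yes (z′ , wz′ , cwz′) = cong just (colour-injective wz′ wz (trans cwz′ (sym cwz)))
  ... | no none              = ⊥-elim (none (_ , wz , cwz))

  next-missing : ∀ {w j} → next w j ≡ nothing → Missing c w j
  next-missing eq z wz cwz with trans (sym eq) (next-complete wz cwz)
  ... | ()

  missing-next : ∀ {w j} → Missing c w j → next w j ≡ nothing
  missing-next {w} {j} miss with next w j in eq
  ... | nothing = refl
  ... | just z  = ⊥-elim (uncurry (miss z) (next-sound eq))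

ColouredIn : ∀ {G D} → ProperEdgeColouring G D → Fin D → Fin D → Fin (n G) → Fin (n G) → Set
ColouredIn c α β u v = ProperEdgeColouring.colour c u v ≡ α ⊎ ProperEdgeColouring.colour c u v ≡ β

record KempeComponent {G : Graph} {D : ℕ} (c : ProperEdgeColouring G D) (x : Fin (n G)) (α β : Fin D) : Set where
  field
    member      : Fin (n G) → Bool
    member-x    : T (member x)
    closed      : ∀ {u v} → Adj G u v → ColouredIn c α β u v → member u ≡ member v
    β-end-unique : ∀ {p q} → Missing c p β → Missing c q β → T (member p) → T (member q) → p ≡ q

-- The component is traced by walking from x along alternately coloured edges, on states (vertex, colour)
-- where σ switches the colour and τ follows the edge of that colour.
module KempeWalk {G : Graph} {D : ℕ} (c : ProperEdgeColouring G D) (x : Fin (n G)) (α β : Fin D)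
    (x-α : Missing c x α) where
  open ProperEdgeColouring c
  open Neighbour c

  State = Fin (n G) × Bool

  colourOf : Bool → Fin D
  colourOf false = α
  colourOf true  = β

  σ τ : State → Maybe State
  σ (w , b) = just (w , not b)
  τ (w , b) = mapMaybe (_, b) (next w (colourOf b))

  τ-edge : ∀ {w z b b′} → τ (w , b) ≡ just (z , b′) → next w (colourOf b) ≡ just z × b′ ≡ b
  τ-edge {w} {b = b} eq with next w (colourOf b)
  τ-edge refl | just z = refl , refl

  τ-from-edge : ∀ {w z b} → next w (colourOf b) ≡ just z → τ (w , b) ≡ just (z , b)
  τ-from-edge eq rewrite eq = refl

  τ-involutive : ∀ {s t} → τ s ≡ just t → τ t ≡ just s
  τ-involutive {w , b} {z , b′} eq with τ-edge eq
  ... | wz , refl = let (e , cwz) = next-sound wz in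
    τ-from-edge (next-complete (Adj-sym G e) (trans (sym (colour-sym e)) cwz))

  τ-fixfree : ∀ {s} → τ s ≢ just s
  τ-fixfree {w , b} eq = Adj-irrefl G (proj₁ (next-sound (proj₁ (τ-edge eq)))) refl

  σ-fixfree : ∀ {s} → σ s ≢ just s
  σ-fixfree {w , false} ()
  σ-fixfree {w , true}  ()

  σ-involutive : ∀ {s t} → σ s ≡ just t → σ t ≡ just s
  σ-involutive {w , b} refl = cong (λ b′ → just (w , b′)) (not-involutive b)

  open AlternatingWalk σ τ σ-involutive τ-involutive σ-fixfree τ-fixfree (x , false)
    (cong (mapMaybe _) (missing-next x-α))

  encode : State → Fin (n G * 2)
  encode (w , false) = combine w zero
  encode (w , true)  = combine w (suc zero)

  encode-injective : ∀ {s t} → encode s ≡ encode t → s ≡ t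
  encode-injective {w , false} {w′ , false} eq = cong (_, false) (proj₁ (combine-injective w _ w′ _ eq))
  encode-injective {w , true}  {w′ , true}  eq = cong (_, true) (proj₁ (combine-injective w _ w′ _ eq))
  encode-injective {w , false} {w′ , true}  eq with proj₂ (combine-injective w _ w′ _ eq)
  ... | ()
  encode-injective {w , true}  {w′ , false} eq with proj₂ (combine-injective w _ w′ _ eq)
  ... | ()

  walk-end : walk (n G * 2) ≡ nothing
  walk-end = walk-ends (n G * 2) encode encode-injective

  Hits : Maybe State → Fin (n G) → Set
  Hits (just (z , _)) w = z ≡ w
  Hits nothing        w = ⊥

  hits? : ∀ s w → Dec (Hits s w)
  hits? (just (z , _)) w = z ≟ᶠ w
  hits? nothing        w = no λ ()

  member? : ∀ w → Dec (∃ λ (i : Fin (n G * 2)) → Hits (walk (toℕ i)) w)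
  member? w = any? (λ i → hits? (walk (toℕ i)) w)

  member : Fin (n G) → Bool
  member w = ⌊ member? w ⌋

  member-intro : ∀ {w b} → Visited (w , b) → T (member w)
  member-intro {w} v with visited-early walk-end v
  ... | i , wi = fromWitness {a? = member? w} (i , subst (λ s → Hits s w) (sym wi) refl)

  member-sound : ∀ {w} → T (member w) → ∃ λ b → Visited (w , b)
  member-sound {w} t with toWitness {a? = member? w} t
  ... | i , hit with walk (toℕ i) in wi
  ...   | just (z , b) = b , toℕ i , trans wi (cong (λ v → just (v , b)) hit)

  visited-colour : ∀ {w} b′ → T (member w) → Visited (w , b′)
  visited-colour {w} b′ t with member-sound t
  ... | b , v with b ≟ᵇ b′
  ...   | yes refl = v
  ...   | no b≢b′  = subst (λ b″ → Visited (w , b″)) (sym (¬-not (b≢b′ ∘ sym))) (visited-σ v refl)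

  closed→ : ∀ {u v} → Adj G u v → colour u v ≡ α ⊎ colour u v ≡ β → T (member u) → T (member v)
  closed→ uv (inj₁ cuv) t = member-intro (visited-τ (visited-colour false t) (τ-from-edge (next-complete uv cuv)))
  closed→ uv (inj₂ cuv) t = member-intro (visited-τ (visited-colour true t) (τ-from-edge (next-complete uv cuv)))

  closed : ∀ {u v} → Adj G u v → colour u v ≡ α ⊎ colour u v ≡ β → member u ≡ member v
  closed {u} {v} uv cuv with member u in mu | member v in mv
  ... | true  | true  = refl
  ... | false | false = refl
  ... | true  | false = ⊥-elim (subst T mv (closed→ uv cuv (subst T (sym mu) tt)))
  ... | false | true  = ⊥-elim (subst T mu (closed→ (Adj-sym G uv)
                          (⊎-map (trans (sym (colour-sym uv))) (trans (sym (colour-sym uv))) cuv)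
                          (subst T (sym mv) tt)))

  β-end : ∀ {p} → Missing c p β → T (member p) → ∃ λ i → walk i ≡ just (p , true) × walk (suc i) ≡ nothing
  β-end {p} p-β t = dead-end (visited-colour true t) (cong (mapMaybe _) (missing-next p-β)) λ ()

  β-end-unique : ∀ {p q} → Missing c p β → Missing c q β → T (member p) → T (member q) → p ≡ q
  β-end-unique p-β q-β tp tq with β-end p-β tp | β-end q-β tq
  ... | i , wi , wi′ | j , wj , wj′ = cong proj₁ (dead-end-unique {i} {j} wi wi′ wj wj′)

-- Opaque for the same reason as missing-colour.
opaque
  kempeComponent : ∀ {G D} (c : ProperEdgeColouring G D) x α β → Missing c x α → KempeComponent c x α β
  kempeComponent c x α β x-α = record
    { member = member ; member-x = member-intro (0 , refl)
    ; closed = closed ; β-end-unique = β-end-unique }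
    where open KempeWalk c x α β x-α

transpose-matchʳ : ∀ {m} (i j : Fin m) → transpose i j j ≡ i
transpose-matchʳ i j with j ≟ᶠ i
... | yes j≡i = j≡i
... | no _ rewrite dec-true (j ≟ᶠ j) refl = refl

transpose-other : ∀ {m} {i j k : Fin m} → k ≢ i → k ≢ j → transpose i j k ≡ k
transpose-other {i = i} {j} {k} k≢i k≢j rewrite dec-false (k ≟ᶠ i) k≢i | dec-false (k ≟ᶠ j) k≢j = refl

transpose-injective : ∀ {m} (i j : Fin m) {k l} → transpose i j k ≡ transpose i j l → k ≡ l
transpose-injective i j {k} {l} eq =
  trans (sym (transpose-inverse j i)) (trans (cong (transpose j i) eq) (transpose-inverse j i))

module KempeSwap {G : Graph} {D : ℕ} (c : ProperEdgeColouring G D) (α β : Fin D) (R : Fin (n G) → Bool)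
    (R-closed : ∀ {u v} → Adj G u v → ColouredIn c α β u v → R u ≡ R v) where
  open ProperEdgeColouring c

  colour′ : Square (Fin D) (n G)
  colour′ u v = if R u then transpose α β (colour u v) else colour u v

  colour′-outside : ∀ {u v} → R u ≡ false → colour′ u v ≡ colour u v
  colour′-outside Ru = if-cong Ru

  boundary-colour : ∀ {u v} → Adj G u v → R u ≡ true → R v ≡ false → transpose α β (colour u v) ≡ colour u v
  boundary-colour {u} {v} uv Ru Rv = transpose-other (crossing ∘ inj₁) (crossing ∘ inj₂)
    where
    crossing : ¬ (colour u v ≡ α ⊎ colour u v ≡ β)
    crossing cuv with trans (sym Ru) (trans (R-closed uv cuv) Rv)
    ... | ()

  colour′-sym : ∀ {u v} → Adj G u v → colour′ u v ≡ colour′ v u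
  colour′-sym {u} {v} uv with R u in Ru | R v in Rv
  ... | true  | true  = cong (transpose α β) (colour-sym uv)
  ... | false | false = colour-sym uv
  ... | true  | false = trans (boundary-colour uv Ru Rv) (colour-sym uv)
  ... | false | true  = trans (colour-sym uv) (sym (boundary-colour (Adj-sym G uv) Rv Ru))

  colour′-injective : ∀ {u v w} → Adj G u v → Adj G u w → colour′ u v ≡ colour′ u w → v ≡ w
  colour′-injective {u} uv uw eq with R u
  ... | true  = colour-injective uv uw (transpose-injective α β eq)
  ... | false = colour-injective uv uw eq

  swapped : ProperEdgeColouring G D
  swapped = record { colour = colour′ ; colour-sym = colour′-sym ; colour-injective = colour′-injective }

  missing-outside : ∀ {w j} → R w ≡ false → Missing c w j → Missing swapped w j
  missing-outside Rw miss z wz eq = miss z wz (trans (sym (colour′-outside Rw)) eq)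

  missing-other : ∀ {w j} → j ≢ α → j ≢ β → Missing c w j → Missing swapped w j
  missing-other {w} {j} j≢α j≢β miss z wz eq with R w
  ... | false = miss z wz eq
  ... | true  = miss z wz (transpose-injective α β (trans eq (sym (transpose-other j≢α j≢β))))

  missing-swapped : ∀ {w} → R w ≡ true → Missing c w β → Missing swapped w α
  missing-swapped Rw miss z wz eq rewrite Rw =
    miss z wz (transpose-injective α β (trans eq (sym (transpose-matchʳ α β))))

edgeMass : Graph → ℕ
edgeMass G = sumFin (n G) (degree G)

count-< : ∀ m (P Q : Fin m → Bool) → (∀ i → T (P i) → T (Q i)) → ∀ i → ¬ T (P i) → T (Q i) →
  count m P < count m Q
count-< m P Q P⊆Q i ¬Pi Qi = sumFin-mono-< m (indicator-mono ∘ P⊆Q) i strict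
  where
  strict : (if P i then 1 else 0) < (if Q i then 1 else 0)
  strict with P i | Q i
  ... | false | true  = s≤s z≤n
  ... | true  | _     = ⊥-elim (¬Pi tt)
  ... | false | false = ⊥-elim Qi

module EdgeDeletion (G : Graph) (x y : Fin (n G)) where

  joins : Fin (n G) → Fin (n G) → Bool
  joins u v = (u == x ∧ v == y) ∨ (u == y ∧ v == x)

  joins-sym : ∀ u v → joins u v ≡ joins v u
  joins-sym u v = trans (∨-comm (u == x ∧ v == y) _) (cong₂ _∨_ (∧-comm (u == y) _) (∧-comm (u == x) _))

  G-xy : Graph
  G-xy = record
    { n       = n G
    ; adj     = λ u v → adj G u v ∧ not (joins u v)
    ; adj-sym = λ u v → cong₂ (λ a j → a ∧ not j) (adj-sym G u v) (joins-sym u v)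
    ; irrefl  = λ v → cong (_∧ not (joins v v)) (irrefl G v)
    }

  G-xy⊆G : ∀ {u v} → Adj G-xy u v → Adj G u v
  G-xy⊆G = proj₁ ∘ Equivalence.to T-∧

  kept : ∀ {u v} → Adj G u v → u ≢ x → v ≢ x → Adj G-xy u v
  kept {u} {v} uv u≢x v≢x = Equivalence.from T-∧ (uv , subst (T ∘ not) (sym not-joins) tt)
    where
    not-joins : joins u v ≡ false
    not-joins rewrite ==-≢ u≢x | ==-≢ v≢x | ∧-zeroʳ (u == y) = refl

  kept-at-x : ∀ {v} → Adj G x v → v ≢ y → Adj G-xy x v
  kept-at-x {v} xv v≢y = Equivalence.from T-∧ (xv , subst (T ∘ not) (sym not-joins) tt)
    where
    not-joins : joins x v ≡ false
    not-joins rewrite ==-≢ v≢y | ==-≢ (Adj-irrefl G xv ∘ sym) | ∧-zeroʳ (x == x) | ∧-zeroʳ (x == y) = refl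

  deleted : ¬ Adj G-xy x y
  deleted t rewrite dec-true (x ≟ᶠ x) refl | dec-true (y ≟ᶠ y) refl = proj₂ (Equivalence.to T-∧ t)

  degree-G-xy : ∀ v → degree G-xy v ≤ degree G v
  degree-G-xy v = count-mono (n G) _ _ (λ u → G-xy⊆G)

  edgeMass-G-xy : Adj G x y → edgeMass G-xy < edgeMass G
  edgeMass-G-xy xy = sumFin-mono-< (n G) degree-G-xy y
    (count-< (n G) (λ u → adj G-xy u y) (λ u → adj G u y) (λ u → G-xy⊆G) x deleted xy)

  record Fan {D : ℕ} (c : ProperEdgeColouring G-xy D) (m : ℕ) : Set where
    field
      fan           : ℕ → Fin (n G)
      β             : ℕ → Fin D
      fan-0         : fan 0 ≡ y
      fan-injective : ∀ {s t} → s ≤ m → t ≤ m → fan s ≡ fan t → s ≡ t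
      fan-adj       : ∀ {t} → t < m → Adj G-xy x (fan (suc t))
      fan-colour    : ∀ {t} → t < m → ProperEdgeColouring.colour c x (fan (suc t)) ≡ β t
      β-missing     : ∀ {t} → t ≤ m → Missing c (fan t) (β t)

  -- Recolour each fan edge x fan(t) with β t, which is missing at fan t and was the colour of
  -- x fan(t + 1); as β m is missing at x, the colours at x stay distinct.
  module Shift {D : ℕ} {c : ProperEdgeColouring G-xy D} {m : ℕ} (F : Fan c m) (x-β : Missing c x (Fan.β F m)) where
    open ProperEdgeColouring c
    open Fan F

    index? : ∀ v → Dec (∃ λ (t : Fin (suc m)) → fan (toℕ t) ≡ v)
    index? v = any? (λ t → fan (toℕ t) ≟ᶠ v)

    choose : ∀ v → Dec (∃ λ (t : Fin (suc m)) → fan (toℕ t) ≡ v) → Fin D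
    choose v (yes (t , _)) = β (toℕ t)
    choose v (no _)        = colour x v

    new : Fin (n G) → Fin D
    new v = choose v (index? v)

    data View (v : Fin (n G)) : Set where
      in-fan  : ∀ t → t ≤ m → fan t ≡ v → new v ≡ β t → View v
      off-fan : (∀ t → t ≤ m → fan t ≢ v) → new v ≡ colour x v → View v

    view : ∀ v → View v
    view v with index? v in eq
    ... | yes (t , ft) = in-fan (toℕ t) (toℕ≤pred[n] t) ft (cong (choose v) eq)
    ... | no none      = off-fan (λ t t≤m ft → none (fromℕ< (s≤s t≤m) , trans (cong fan (toℕ-fromℕ< _)) ft))
                           (cong (choose v) eq)

    off-fan-kept : ∀ {v} → (∀ t → t ≤ m → fan t ≢ v) → Adj G x v → Adj G-xy x v
    off-fan-kept off xv = kept-at-x xv (λ v≡y → off 0 z≤n (trans fan-0 (sym v≡y)))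

    β-injective : ∀ {s t} → s ≤ m → t ≤ m → β s ≡ β t → s ≡ t
    β-injective {s} {t} s≤m t≤m eq with m≤n⇒m<n∨m≡n s≤m | m≤n⇒m<n∨m≡n t≤m
    ... | inj₁ s<m  | inj₁ t<m  = suc-injective (fan-injective s<m t<m
            (colour-injective (fan-adj s<m) (fan-adj t<m) (trans (fan-colour s<m) (trans eq (sym (fan-colour t<m))))))
    ... | inj₂ refl | inj₂ refl = refl
    ... | inj₁ s<m  | inj₂ refl = ⊥-elim (x-β _ (fan-adj s<m) (trans (fan-colour s<m) eq))
    ... | inj₂ refl | inj₁ t<m  = ⊥-elim (x-β _ (fan-adj t<m) (trans (fan-colour t<m) (sym eq)))

    fan≢off-fan : ∀ {t v} → t ≤ m → (∀ s → s ≤ m → fan s ≢ v) → Adj G x v → β t ≢ colour x v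
    fan≢off-fan {t} t≤m off xv eq with m≤n⇒m<n∨m≡n t≤m
    ... | inj₁ t<m  = off (suc t) t<m (colour-injective (fan-adj t<m) (off-fan-kept off xv) (trans (fan-colour t<m) eq))
    ... | inj₂ refl = x-β _ (off-fan-kept off xv) (sym eq)

    new-injective : ∀ {v w} → Adj G x v → Adj G x w → new v ≡ new w → v ≡ w
    new-injective {v} {w} xv xw eq with view v | view w
    ... | in-fan s s≤m fs nv | in-fan t t≤m ft nw =
      trans (sym fs) (trans (cong fan (β-injective s≤m t≤m (trans (sym nv) (trans eq nw)))) ft)
    ... | in-fan s s≤m _ nv  | off-fan off nw = ⊥-elim (fan≢off-fan s≤m off xw (trans (sym nv) (trans eq nw)))
    ... | off-fan off nv     | in-fan t t≤m _ nw = ⊥-elim (fan≢off-fan t≤m off xv (trans (sym nw) (trans (sym eq) nv)))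
    ... | off-fan offv nv    | off-fan offw nw =
      colour-injective (off-fan-kept offv xv) (off-fan-kept offw xw) (trans (sym nv) (trans eq nw))

    new-fresh : ∀ {u w} → Adj G u x → Adj G u w → w ≢ x → new u ≢ colour u w
    new-fresh {u} {w} ux uw w≢x eq with view u
    ... | in-fan t t≤m refl nu = β-missing t≤m w (kept uw u≢x w≢x) (trans (sym eq) nu)
      where u≢x = Adj-irrefl G ux
    ... | off-fan off nu = w≢x (colour-injective (kept uw u≢x w≢x) (Adj-sym G-xy xu)
                             (sym (trans (sym (colour-sym xu)) (trans (sym nu) eq))))
      where
      u≢x = Adj-irrefl G ux
      xu  = off-fan-kept off (Adj-sym G ux)

    colour′ : Square (Fin D) (n G)
    colour′ u v = if u == x then new v else if v == x then new u else colour u v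

    colour′-from-x : ∀ v → colour′ x v ≡ new v
    colour′-from-x v = if-cong (dec-true (x ≟ᶠ x) refl)

    colour′-to-x : ∀ {u} → u ≢ x → colour′ u x ≡ new u
    colour′-to-x u≢x = trans (if-cong (==-≢ u≢x)) (if-cong (dec-true (x ≟ᶠ x) refl))

    colour′-away : ∀ {u v} → u ≢ x → v ≢ x → colour′ u v ≡ colour u v
    colour′-away u≢x v≢x = trans (if-cong (==-≢ u≢x)) (if-cong (==-≢ v≢x))

    colour′-sym : ∀ {u v} → Adj G u v → colour′ u v ≡ colour′ v u
    colour′-sym {u} {v} uv = by-cases (u ≟ᶠ x) (v ≟ᶠ x)
      where
      by-cases : Dec (u ≡ x) → Dec (v ≡ x) → colour′ u v ≡ colour′ v u
      by-cases (yes refl) (yes refl) = ⊥-elim (Adj-irrefl G uv refl)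
      by-cases (yes refl) (no v≢x)   = trans (colour′-from-x v) (sym (colour′-to-x v≢x))
      by-cases (no u≢x)   (yes refl) = trans (colour′-to-x u≢x) (sym (colour′-from-x u))
      by-cases (no u≢x)   (no v≢x)   =
        trans (colour′-away u≢x v≢x) (trans (colour-sym (kept uv u≢x v≢x)) (sym (colour′-away v≢x u≢x)))

    colour′-injective : ∀ {u v w} → Adj G u v → Adj G u w → colour′ u v ≡ colour′ u w → v ≡ w
    colour′-injective {u} {v} {w} uv uw eq = by-cases (u ≟ᶠ x) (v ≟ᶠ x) (w ≟ᶠ x)
      where
      by-cases : Dec (u ≡ x) → Dec (v ≡ x) → Dec (w ≡ x) → v ≡ w
      by-cases (yes refl) _ _ = new-injective uv uw (trans (sym (colour′-from-x v)) (trans eq (colour′-from-x w)))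
      by-cases (no u≢x) (yes refl) (yes refl) = refl
      by-cases (no u≢x) (yes refl) (no w≢x)   =
        ⊥-elim (new-fresh uv uw w≢x (trans (sym (colour′-to-x u≢x)) (trans eq (colour′-away u≢x w≢x))))
      by-cases (no u≢x) (no v≢x)   (yes refl) =
        ⊥-elim (new-fresh uw uv v≢x (trans (sym (colour′-to-x u≢x)) (trans (sym eq) (colour′-away u≢x v≢x))))
      by-cases (no u≢x) (no v≢x)   (no w≢x)   = colour-injective (kept uv u≢x v≢x) (kept uw u≢x w≢x)
        (trans (sym (colour′-away u≢x v≢x)) (trans eq (colour′-away u≢x w≢x)))

    shifted : ProperEdgeColouring G D
    shifted = record { colour = colour′ ; colour-sym = colour′-sym ; colour-injective = colour′-injective }

module Extension (G : Graph) (Δ : ℕ) (deg : ∀ v → degree G v ≤ Δ) (x y : Fin (n G)) (xy : Adj G x y)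
    (c : ProperEdgeColouring (EdgeDeletion.G-xy G x y) (suc Δ)) where
  open EdgeDeletion G x y
  open ProperEdgeColouring c
  open Neighbour c

  missing : Fin (n G) → Fin (suc Δ)
  missing w = proj₁ (missing-colour c w (s≤s (≤-trans (degree-G-xy w) (deg w))))

  missing-spec : ∀ w → Missing c w (missing w)
  missing-spec w = proj₂ (missing-colour c w (s≤s (≤-trans (degree-G-xy w) (deg w))))

  -- y is only a default: fan (suc t) is used only where FanUpTo.linked says the neighbour exists.
  fan : ℕ → Fin (n G)
  fan zero    = y
  fan (suc t) = fromMaybe y (next x (missing (fan t)))

  record FanUpTo (k : ℕ) : Set where
    field
      injective : ∀ {s t} → s ≤ k → t ≤ k → fan s ≡ fan t → s ≡ t
      linked    : ∀ {t} → t < k → next x (missing (fan t)) ≡ just (fan (suc t))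

  mkFan : (c′ : ProperEdgeColouring G-xy (suc Δ)) → (∀ {w} → ProperEdgeColouring.colour c′ x w ≡ colour x w) →
    ∀ {m k} → m ≤ k → FanUpTo k → (β : ℕ → Fin (suc Δ)) → (∀ {t} → t < m → β t ≡ missing (fan t)) →
    (∀ {t} → t ≤ m → Missing c′ (fan t) (β t)) → Fan c′ m
  mkFan c′ same-at-x m≤k F β β-below β-missing = record
    { fan = fan ; β = β ; fan-0 = refl
    ; fan-injective = λ s≤m t≤m → FanUpTo.injective F (≤-trans s≤m m≤k) (≤-trans t≤m m≤k)
    ; fan-adj       = λ t<m → proj₁ (next-sound (FanUpTo.linked F (<-≤-trans t<m m≤k)))
    ; fan-colour    = λ t<m → trans same-at-x (trans (proj₂ (next-sound (FanUpTo.linked F (<-≤-trans t<m m≤k))))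
                                                    (sym (β-below t<m)))
    ; β-missing     = β-missing
    }

  open Shift using (shifted)

  fan-closes : ∀ k → FanUpTo k → next x (missing (fan k)) ≡ nothing → ProperEdgeColouring G (suc Δ)
  fan-closes k F none = shifted (mkFan c refl ≤-refl F (missing ∘ fan) (λ _ → refl) (λ _ → missing-spec _))
    (next-missing none)

  retarget : ℕ → Fin (suc Δ) → ℕ → Fin (suc Δ)
  retarget m γ t with t ≟ m
  ... | yes _ = γ
  ... | no _  = missing (fan t)

  retarget-last : ∀ m γ → retarget m γ m ≡ γ
  retarget-last m γ with m ≟ m
  ... | yes _  = refl
  ... | no m≢m = ⊥-elim (m≢m refl)

  retarget-other : ∀ {m γ t} → t ≢ m → retarget m γ t ≡ missing (fan t)
  retarget-other {m} {γ} {t} t≢m with t ≟ m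
  ... | yes t≡m = ⊥-elim (t≢m t≡m)
  ... | no _    = refl

  -- The fan runs into fan (suc j) with j < k, so fan j and fan k miss the same colour β.  The {α, β}-path
  -- from x (which misses α) ends in at most one of them; swapping α and β away from it lets whichever of
  -- fan j, fan k lies off the path miss α, and the fan up to that vertex can be shifted.
  fan-repeats : ∀ k j → j < k → FanUpTo k → next x (missing (fan k)) ≡ just (fan (suc j)) →
    ProperEdgeColouring G (suc Δ)
  fan-repeats k j j<k F eq = by-membership (member (fan j)) refl
    where
    open FanUpTo F
    α = missing x
    β = missing (fan k)
    open KempeComponent (kempeComponent c x α β (missing-spec x))
    open KempeSwap c α β (not ∘ member) (λ uv cuv → cong not (closed uv cuv))

    x-inside : not (member x) ≡ false
    x-inside = cong not (Equivalence.to T-≡ member-x)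

    colour-fan : ∀ {t} → t < k → colour x (fan (suc t)) ≡ missing (fan t)
    colour-fan t<k = proj₂ (next-sound (linked t<k))

    j-β : missing (fan j) ≡ β
    j-β = trans (sym (colour-fan j<k)) (proj₂ (next-sound eq))

    fan-j≢fan-k : fan j ≢ fan k
    fan-j≢fan-k e = <-irrefl (injective (<⇒≤ j<k) ≤-refl e) j<k

    missing≢α : ∀ {t} → t < k → missing (fan t) ≢ α
    missing≢α t<k e = missing-spec x _ (proj₁ (next-sound (linked t<k))) (trans (colour-fan t<k) e)

    missing≢β : ∀ {t} → t < k → t ≢ j → missing (fan t) ≢ β
    missing≢β t<k t≢j e = t≢j (suc-injective (injective t<k j<k (colour-injective
      (proj₁ (next-sound (linked t<k))) (proj₁ (next-sound (linked j<k)))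
      (trans (colour-fan t<k) (trans e (sym (trans (colour-fan j<k) j-β)))))))

    missing-kept : ∀ {t} → t < k → t ≢ j → Missing swapped (fan t) (missing (fan t))
    missing-kept t<k t≢j = missing-other (missing≢α t<k) (missing≢β t<k t≢j) (missing-spec _)

    shift-to : ∀ m → m ≤ k → (∀ {t} → t ≤ m → Missing swapped (fan t) (retarget m α t)) →
      ProperEdgeColouring G (suc Δ)
    shift-to m m≤k β-missing = shifted
      (mkFan swapped (colour′-outside x-inside) m≤k F (retarget m α) (retarget-other ∘ <⇒≢) β-missing)
      (subst (Missing swapped x) (sym (retarget-last m α)) (missing-outside x-inside (missing-spec x)))

    by-membership : ∀ b → member (fan j) ≡ b → ProperEdgeColouring G (suc Δ)
    by-membership false off = shift-to j (<⇒≤ j<k) β-missing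
      where
      β-missing : ∀ {t} → t ≤ j → Missing swapped (fan t) (retarget j α t)
      β-missing {t} t≤j with m≤n⇒m<n∨m≡n t≤j
      ... | inj₂ refl = subst (Missing swapped (fan t)) (sym (retarget-last t α))
                          (missing-swapped (cong not off) (subst (Missing c (fan t)) j-β (missing-spec (fan t))))
      ... | inj₁ t<j  = subst (Missing swapped (fan t)) (sym (retarget-other (<⇒≢ t<j)))
                          (missing-kept (<-trans t<j j<k) (<⇒≢ t<j))
    by-membership true on = shift-to k ≤-refl β-missing
      where
      k-off : not (member (fan k)) ≡ true
      k-off with member (fan k) in on-k
      ... | false = refl
      ... | true  = ⊥-elim (fan-j≢fan-k (β-end-unique
              (subst (Missing c (fan j)) j-β (missing-spec (fan j))) (missing-spec (fan k))
              (subst T (sym on) tt) (subst T (sym on-k) tt)))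
      β-missing : ∀ {t} → t ≤ k → Missing swapped (fan t) (retarget k α t)
      β-missing {t} t≤k with m≤n⇒m<n∨m≡n t≤k
      ... | inj₂ refl = subst (Missing swapped (fan t)) (sym (retarget-last t α))
                          (missing-swapped k-off (missing-spec (fan t)))
      ... | inj₁ t<k with t ≟ j
      ...   | yes refl = subst (Missing swapped (fan t)) (sym (retarget-other (<⇒≢ t<k)))
                           (missing-outside (cong not on) (missing-spec (fan t)))
      ...   | no t≢j   = subst (Missing swapped (fan t)) (sym (retarget-other (<⇒≢ t<k))) (missing-kept t<k t≢j)

  fan-too-long : ∀ {k} → k ≡ n G → FanUpTo k → ⊥
  fan-too-long {k} refl F = <-irrefl refl (injective⇒≤ {f = fan ∘ toℕ} λ {s} {t} eq →
    toℕ-injective (FanUpTo.injective F (toℕ≤pred[n] s) (toℕ≤pred[n] t) eq))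

  fan-extend : ∀ {k z} → FanUpTo k → next x (missing (fan k)) ≡ just z → (∀ t → t ≤ k → fan t ≢ z) →
    FanUpTo (suc k)
  fan-extend {k} {z} F nxt fresh = record { injective = injective′ ; linked = linked′ }
    where
    open FanUpTo F
    fan-suc : fan (suc k) ≡ z
    fan-suc rewrite nxt = refl
    injective′ : ∀ {s t} → s ≤ suc k → t ≤ suc k → fan s ≡ fan t → s ≡ t
    injective′ s≤ t≤ eq with m≤n⇒m<n∨m≡n s≤ | m≤n⇒m<n∨m≡n t≤
    ... | inj₁ (s≤s s≤k) | inj₁ (s≤s t≤k) = injective s≤k t≤k eq
    ... | inj₂ refl      | inj₂ refl      = refl
    ... | inj₁ (s≤s s≤k) | inj₂ refl      = ⊥-elim (fresh _ s≤k (trans eq fan-suc))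
    ... | inj₂ refl      | inj₁ (s≤s t≤k) = ⊥-elim (fresh _ t≤k (trans (sym eq) fan-suc))
    linked′ : ∀ {t} → t < suc k → next x (missing (fan t)) ≡ just (fan (suc t))
    linked′ (s≤s t≤k) with m≤n⇒m<n∨m≡n t≤k
    ... | inj₁ t<k  = linked t<k
    ... | inj₂ refl = trans nxt (cong just (sym fan-suc))

  grow : ∀ fuel k → k + fuel ≡ n G → FanUpTo k → ProperEdgeColouring G (suc Δ)
  grow zero k eq F = ⊥-elim (fan-too-long (trans (sym (+-identityʳ k)) eq) F)
  grow (suc fuel) k eq F with next x (missing (fan k)) in nxt
  ... | nothing = fan-closes k F nxt
  ... | just z with any? (λ (t : Fin (suc k)) → fan (toℕ t) ≟ᶠ z)
  ...   | yes (t , ft) = repeat (toℕ t) (toℕ≤pred[n] t) ft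
    where
    repeat : ∀ t → t ≤ k → fan t ≡ z → ProperEdgeColouring G (suc Δ)
    repeat zero    _     refl = ⊥-elim (deleted (proj₁ (next-sound nxt)))
    repeat (suc j) j<k   fj   = fan-repeats k j j<k F (trans nxt (cong just (sym fj)))
  ...   | no fresh = grow fuel (suc k) (trans (sym (+-suc k fuel)) eq) (fan-extend F nxt λ t t≤k ft →
            fresh (fromℕ< (s≤s t≤k) , trans (cong fan (toℕ-fromℕ< (s≤s t≤k))) ft))

  extended : ProperEdgeColouring G (suc Δ)
  extended = grow (n G) 0 refl (record { injective = λ { z≤n z≤n _ → refl } ; linked = λ () })

vizing : ∀ Δ G → (∀ v → degree G v ≤ Δ) → ProperEdgeColouring G (suc Δ)
vizing Δ = All.wfRec (On.wellFounded edgeMass <-wellFounded) _ Colourable step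
  where
  Colourable : Graph → Set
  Colourable G = (∀ v → degree G v ≤ Δ) → ProperEdgeColouring G (suc Δ)
  step : ∀ G → (∀ {G′} → edgeMass G′ < edgeMass G → Colourable G′) → Colourable G
  step G smaller deg with any? (λ x → any? (λ y → T? (adj G x y)))
  ... | no edgeless = record
    { colour = λ _ _ → zero
    ; colour-sym = λ uv → ⊥-elim (edgeless (_ , _ , uv))
    ; colour-injective = λ uv _ _ → ⊥-elim (edgeless (_ , _ , uv)) }
  ... | yes (x , y , xy) = Extension.extended G Δ deg x y xy
          (smaller (edgeMass-G-xy xy) (λ v → ≤-trans (degree-G-xy v) (deg v)))
    where open EdgeDeletion G x y

mainTheorem1 : (G : Graph) → Σ ℕ (λ k → IsUniversalLabelingNumber G k ×
                 ((2 * maxDegree G ∸ 2 ≤ k) × (k ≤ 2 ^ maxDegree G)))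
mainTheorem1 G with universalLabelingNumber G (2 ^ maxDegree G) (ℓ , labeling , universal)
  where open PowersOfTwo (vizing (maxDegree G) G (maxFin-ub (n G) (degree G)))
... | k , isNumber , k≤2^Δ = k , isNumber , lowerBound G k (proj₁ isNumber) , k≤2^Δ
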